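{- Let $G$ be a finite simple graph on the vertex set $V$ which has a dominating induced matching. The following are equivalent: (a) $G$ is unmixed; (b) there exists an admissible decomposition $V = W \sqcup M$ satisfying condition $(\flat)$; (c) every admissible decomposition $V = W \sqcup M$ satisfies condition $(\flat)$. Here, for an admissible decomposition $V = W \sqcup M$ with $G_M$ consisting of the $m$ disjoint edges $\{x_{j1}, x_{j2}\}$, $j = 1, \ldots, m$, condition $(\flat)$ is: for every subset $M_2 \subseteq M$ (the empty set included) such that $(\ast 1)$ $\#(M_2 \cap \{x_{j1}, x_{j2}\}) \le 1$ for all $j = 1, \ldots, m$, and $(\ast 2)$ $\deg_G x \ge 2$ for all $x \in M_2$, the following two conditions hold: \[ (\flat 1)\quad m_2 - m_2' = \# N_G(M_2) - \# M_2, \qquad (\flat 2)\quad \# W_0 \le 2 m_2 - \# N_G(M_2) + \# M_2 + \# IN_G(M_2, W). \]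
   Context: All graphs are finite and simple. A matching is a set of pairwise disjoint edges; it is maximal if no further edge can be added. Two edges $e,e'$ are $3$-disjoint if $e\cap e'=\emptyset$ and no edge meets both; an induced matching is a set of pairwise $3$-disjoint edges. A dominating induced matching is an induced matching which is also a maximal matching. For $W \subseteq V$, $G_W$ denotes the induced subgraph on $W$ and $G \setminus W$ denotes $G_{V \setminus W}$. $N_G(x)$ is the set of neighbours of $x$, $N_G[x] = N_G(x) \cup \{x\}$, $\deg_G x = \# N_G(x)$, and for $U \subseteq V$, $N_G(U) = \bigcup_{x \in U} N_G(x)$, $N_G[U] = \bigcup_{x \in U} N_G[x]$. A set of vertices is independent if no two of its vertices are adjacent. A vertex cover is a set of vertices meeting every edge; $G$ is unmixed if all minimal vertex covers of $G$ have the same cardinality. An admissible decomposition is a partition $V = W \sqcup M$ such that $W$ is an independent set of $G$ and the induced subgraph $G_M$ is a disjoint union of $m$ edges $\{x_{j1}, x_{j2}\}$, $j = 1, \ldots, m$ (such a decomposition exists precisely when $G$ has a dominating induced matching). Given such a decomposition: $W_0$ is the set of vertices of $W$ that are not isolated in $G$; $m_2$ is the number of indices $j$ with $\deg_G x_{j1} \ge 2$ and $\deg_G x_{j2} \ge 2$; for $U \subseteq V$, $IN_G(U, W)$ is the set of isolated vertices of $G \setminus N_G[U]$ that belong to $W_0$. For $M_2 \subseteq M$, let $G' = G \setminus N_G[M_2]$, and let $m_2'$ be the number of indices $j$ such that both $x_{j1}, x_{j2}$ are vertices of $G'$ and $\deg_{G'} x_{j1} \ge 2$ and $\deg_{G'}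 x_{j2} \ge 2$ (in particular $m_2' = 0$ if $G'$ has no edges). -}

module Defs where

open import Data.Bool using (Bool; true; false; _∧_; _∨_; not)
open import Data.Nat using (ℕ; _≤_; _+_; _*_; _≤ᵇ_)
open import Data.Fin using (Fin; zero; suc)
open import Data.Fin.Subset using (Subset; _∈_; _∉_; _⊆_; ∁; _∩_; _∪_; ∣_∣)
open import Data.Vec using (tabulate; lookup)
open import Data.Product using (Σ; ∃; _×_; _,_)
open import Data.Sum using (_⊎_)
open import Relation.Binary.PropositionalEquality using (_≡_)
open import Relation.Nullary using (¬_)
open import Function.Bundles using (_⇔_)

record Graph (n : ℕ) : Set where
  field
    adj   : Fin n → Fin n → Bool
    sym   : ∀ u v → adj u v ≡ adj v u
    irref : ∀ u → adj u u ≡ false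

module _ {n : ℕ} (G : Graph n) where
  open Graph G

  Edge : Fin n → Fin n → Set
  Edge u v = adj u v ≡ true

  anyᶠ : ∀ {k} → (Fin k → Bool) → Bool
  anyᶠ {ℕ.zero}  f = false
  anyᶠ {ℕ.suc k} f = f zero ∨ anyᶠ (λ i → f (suc i))

  N : Fin n → Subset n
  N x = tabulate (adj x)

  deg : Fin n → ℕ
  deg x = ∣ N x ∣

  NS : Subset n → Subset n
  NS U = tabulate (λ y → anyᶠ (λ x → lookup U x ∧ adj x y))

  NS[] : Subset n → Subset n
  NS[] U = U ∪ NS U

  -- degree of x in the induced subgraph G \ N_G[U]  (for x ∉ N_G[U])
  degOut : Subset n → Fin n → ℕ
  degOut U x = ∣ N x ∩ ∁ (NS[] U) ∣

  -- set of isolated vertices of G \ N_G[U]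
  Isolated : Subset n → Subset n
  Isolated U = tabulate (λ y → not (lookup (NS[] U) y) ∧ not (anyᶠ (λ z → adj y z ∧ not (lookup (NS[] U) z))))

  IsVertexCover : Subset n → Set
  IsVertexCover C = ∀ u v → Edge u v → u ∈ C ⊎ v ∈ C

  IsMinimalVertexCover : Subset n → Set
  IsMinimalVertexCover C = IsVertexCover C × (∀ D → D ⊆ C → IsVertexCover D → D ≡ C)

  Unmixed : Set
  Unmixed = ∀ C D → IsMinimalVertexCover C → IsMinimalVertexCover D → ∣ C ∣ ≡ ∣ D ∣

  -- matchings.  A set of edges is a predicate S on ordered pairs; the
  -- (unordered) edge {a,b} belongs to the set when S a b holds.

  EdgeSet : Set₁
  EdgeSet = Fin n → Fin n → Set

  SameE : Fin n → Fin n → Fin n → Fin n → Set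
  SameE a b c d = (a ≡ c × b ≡ d) ⊎ (a ≡ d × b ≡ c)

  On : Fin n → Fin n → Fin n → Set
  On x a b = x ≡ a ⊎ x ≡ b

  DisjointE : Fin n → Fin n → Fin n → Fin n → Set
  DisjointE a b c d = ¬ On a c d × ¬ On b c d

  MeetsBoth : Fin n → Fin n → Fin n → Fin n → Set
  MeetsBoth a b c d =
    Σ (Fin n) λ p → Σ (Fin n) λ q → Edge p q
      × (On p a b ⊎ On q a b) × (On p c d ⊎ On q c d)

  ThreeDisjoint : Fin n → Fin n → Fin n → Fin n → Set
  ThreeDisjoint a b c d = DisjointE a b c d × ¬ MeetsBoth a b c d

  IsMatching : EdgeSet → Set
  IsMatching S = (∀ a b → S a b → Edge a b)
    × (∀ a b c d → S a b → S c d → ¬ SameE a b c d → DisjointE a b c d)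

  IsMaximalMatching : EdgeSet → Set
  IsMaximalMatching S = IsMatching S
    × (∀ u v → Edge u v → ¬ (S u v ⊎ S v u)
         → ¬ IsMatching (λ a b → S a b ⊎ SameE a b u v))

  IsInducedMatching : EdgeSet → Set
  IsInducedMatching S = (∀ a b → S a b → Edge a b)
    × (∀ a b c d → S a b → S c d → ¬ SameE a b c d → ThreeDisjoint a b c d)

  IsDominatingInducedMatching : EdgeSet → Set
  IsDominatingInducedMatching S = IsInducedMatching S × IsMaximalMatching S

  HasDIM : Set₁
  HasDIM = Σ EdgeSet IsDominatingInducedMatching

  Independent : Subset n → Set
  Independent U = ∀ u v → u ∈ U → v ∈ U → ¬ Edge u v

  record AdmDec : Set where
    field
      W  : Subset n
      m  : ℕ
      x₁ : Fin m → Fin n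
      x₂ : Fin m → Fin n

    M : Subset n
    M = ∁ W

    InPairs : Fin n → Set
    InPairs v = Σ (Fin m) λ j → v ≡ x₁ j ⊎ v ≡ x₂ j

    field
      W-indep   : Independent W
      x₁-inj    : ∀ j k → x₁ j ≡ x₁ k → j ≡ k
      x₂-inj    : ∀ j k → x₂ j ≡ x₂ k → j ≡ k
      x₁≢x₂     : ∀ j k → ¬ x₁ j ≡ x₂ k
      M-pairs   : ∀ v → v ∈ M → InPairs v
      pairs-M   : ∀ v → InPairs v → v ∈ M
      pair-edge : ∀ j → Edge (x₁ j) (x₂ j)
      M-induced : ∀ u v → u ∈ M → v ∈ M → Edge u v →
                  Σ (Fin m) λ j → SameE u v (x₁ j) (x₂ j)

    W₀ : Subset n
    W₀ = tabulate (λ v → lookup W v ∧ (1 ≤ᵇ deg v))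

    m₂ : ℕ
    m₂ = ∣ tabulate {n = m} (λ j → (2 ≤ᵇ deg (x₁ j)) ∧ (2 ≤ᵇ deg (x₂ j))) ∣

    -- m₂' for G' = G \ N_G[M₂]
    m₂′ : Subset n → ℕ
    m₂′ M₂ = ∣ tabulate {n = m} (λ j →
                 not (lookup (NS[] M₂) (x₁ j)) ∧ not (lookup (NS[] M₂) (x₂ j))
                 ∧ (2 ≤ᵇ degOut M₂ (x₁ j)) ∧ (2 ≤ᵇ degOut M₂ (x₂ j))) ∣

    IN : Subset n → Subset n
    IN U = Isolated U ∩ W₀

    AdmissibleM₂ : Subset n → Set
    AdmissibleM₂ M₂ = M₂ ⊆ M
      × (∀ j → ¬ (x₁ j ∈ M₂ × x₂ j ∈ M₂))
      × (∀ x → x ∈ M₂ → 2 ≤ deg x)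

    -- (♭1)  m₂ − m₂' = #N(M₂) − #M₂, written without subtraction
    Flat1 : Subset n → Set
    Flat1 M₂ = m₂ + ∣ M₂ ∣ ≡ ∣ NS M₂ ∣ + m₂′ M₂

    -- (♭2)  #W₀ ≤ 2 m₂ − #N(M₂) + #M₂ + #IN(M₂,W), written without subtraction
    Flat2 : Subset n → Set
    Flat2 M₂ = ∣ W₀ ∣ + ∣ NS M₂ ∣ ≤ 2 * m₂ + ∣ M₂ ∣ + ∣ IN M₂ ∣

    Flat : Set
    Flat = ∀ M₂ → AdmissibleM₂ M₂ → Flat1 M₂ × Flat2 M₂

module Submission where

-- Fix an admissible decomposition V = W ⊔ M. For T ⊆ M meeting every edge of G_M at most once,
-- C_T = (M ∖ T) ∪ (W ∩ N(T)) is a vertex cover with |C_T| + |T| = |M| + |W ∩ N(T)|, and every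
-- minimal cover C equals C_T for T = M ∖ C. For such T and M₂ = {x ∈ T : deg x ≥ 2} one has
-- W ∩ N(T) = W ∩ N(M₂), and T misses exactly the m₂′ edges counted for M₂, so (♭1) shows that
-- every minimal cover has |M| − m + m₂ vertices. Conversely, let R(M₂) be the minimal cover taking
-- the M₂-vertex of each edge of G_M, else a vertex with at most one neighbour in G′, and skipping
-- the edges counted by m₂′; R(∅) has |M| − m + m₂ vertices. If G is unmixed, comparing it with
-- R(M₂) gives (♭1), and with the two covers taking the first, resp. second, vertex of every edge
-- outside M₂ gives (♭2). Admissible decompositions exist: take for W the vertices missed by a
-- dominating induced matching.

open import Data.Bool using (Bool; true; false; _∧_; _∨_; not; if_then_else_)
open import Data.Bool.Properties using (¬-not; not-injective; not-involutive; T-≡; ∧-zeroʳ; ∧-identityʳ) renaming (_≟_ to _≟ᵇ_)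
open import Data.Empty using (⊥; ⊥-elim)
open import Data.Fin using (Fin; zero; suc; toℕ)
open import Data.Fin.Properties using (_≟_; any?; all?; suc-injective; toℕ-injective)
open import Data.Fin.Subset using (Subset; _∈_; _∉_; _⊆_; ∁; _∩_; _-_; ∣_∣) renaming (⊥ to ∅)
open import Data.Fin.Subset.Properties using (_∈?_; anySubset?; x∈∁p⇒x∉p; x∉p⇒x∈∁p; ⊆-antisym; p─q⊆p; x∈p∧x≢y⇒x∈p-y; x∈p⇒p-x⊂p)
open import Data.Nat using (ℕ; zero; suc; _+_; _*_; _≤_; _<_; _≤ᵇ_; _<ᵇ_; z≤n; s≤s)
open import Data.Nat.Properties
  using (+-0-commutativeMonoid; +-commutativeSemigroup; +-assoc; +-comm; +-identityʳ; +-cancelˡ-≡; +-cancelʳ-≡;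
         ≤-reflexive; ≤-trans; +-mono-≤; +-monoˡ-≤; +-monoʳ-≤; +-cancelˡ-≤; m≤m+n; m≤n+m; 0≢1+n;
         <-asym; <-cmp; ≤ᵇ⇒≤; ≤⇒≤ᵇ; <ᵇ⇒<; <⇒<ᵇ; module ≤-Reasoning)
  renaming (_≟_ to _≟ℕ_)
open import Data.Nat.Tactic.RingSolver using (solve-∀)
open import Data.Product using (Σ; _×_; _,_; proj₁; proj₂)
open import Data.Sum using (_⊎_; inj₁; inj₂; [_,_]′)
open import Data.Vec using (_∷_; []; lookup; tabulate)
open import Data.Vec.Properties using (lookup∘tabulate; lookup-replicate; lookup-zipWith; lookup-map; []=⇒lookup; lookup⇒[]=)
open import Data.Vec.Functional using (updateAt)
open import Data.Vec.Functional.Properties using (updateAt-updates; updateAt-minimal)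
open import Function using (_∘_; const; Equivalence; _⇔_; mk⇔)
open import Relation.Binary.PropositionalEquality
open import Relation.Nullary using (¬_; Dec; yes; no; ¬?; contradiction)
open import Relation.Nullary.Decidable using (_×-dec_; _→-dec_; does; dec-true; dec-false; decidable-stable; ¬¬-excluded-middle)
open import Relation.Binary.Definitions using (tri<; tri≈; tri>)

open import Defs

open import Algebra.Properties.CommutativeSemigroup +-commutativeSemigroup using (x∙yz≈y∙xz)
open import Algebra.Properties.CommutativeMonoid.Sum +-0-commutativeMonoid using (sum; sum-cong-≗; ∑-distrib-+)

true≢false : true ≢ false
true≢false ()

∧-true⁻ : ∀ {a b} → a ∧ b ≡ true → a ≡ true × b ≡ true
∧-true⁻ {true} {true} _ = refl , refl

∧-true⁺ : ∀ {a b} → a ≡ true → b ≡ true → a ∧ b ≡ true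
∧-true⁺ refl refl = refl

∨-true⁻ : ∀ {a b} → a ∨ b ≡ true → a ≡ true ⊎ b ≡ true
∨-true⁻ {true} _ = inj₁ refl
∨-true⁻ {false} b = inj₂ b

∨-true⁺ˡ : ∀ {a b} → a ≡ true → a ∨ b ≡ true
∨-true⁺ˡ refl = refl

∨-true⁺ʳ : ∀ {a b} → b ≡ true → a ∨ b ≡ true
∨-true⁺ʳ {true} _ = refl
∨-true⁺ʳ {false} b = b

not-true⁻ : ∀ {a} → not a ≡ true → a ≡ false
not-true⁻ e = not-injective e

nor-true⁻ : ∀ {a b} → not (a ∨ b) ≡ true → a ≡ false × b ≡ false
nor-true⁻ {false} {false} _ = refl , refl

bool-ext : ∀ {a b} → (a ≡ true → b ≡ true) → (b ≡ true → a ≡ true) → a ≡ b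
bool-ext {false} {false} _ _ = refl
bool-ext {false} {true} _ b⇒a = b⇒a refl
bool-ext {true} {false} a⇒b _ = sym (a⇒b refl)
bool-ext {true} {true} _ _ = refl

≤ᵇ-true⁻ : ∀ {a b} → (a ≤ᵇ b) ≡ true → a ≤ b
≤ᵇ-true⁻ {a} {b} e = ≤ᵇ⇒≤ a b (Equivalence.from T-≡ e)

≤ᵇ-true⁺ : ∀ {a b} → a ≤ b → (a ≤ᵇ b) ≡ true
≤ᵇ-true⁺ a≤b = Equivalence.to T-≡ (≤⇒≤ᵇ a≤b)

𝟙 : Bool → ℕ
𝟙 true = 1
𝟙 false = 0

𝟙≤1 : ∀ b → 𝟙 b ≤ 1
𝟙≤1 true = s≤s z≤n
𝟙≤1 false = z≤n

𝟙≢0⇒true : ∀ {b} → 𝟙 b ≢ 0 → b ≡ true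
𝟙≢0⇒true {true} _ = refl
𝟙≢0⇒true {false} h = ⊥-elim (h refl)

𝟙-∧≤ : ∀ a b → 𝟙 (a ∧ b) ≤ 𝟙 a
𝟙-∧≤ true b = 𝟙≤1 b
𝟙-∧≤ false b = z≤n

count : ∀ {k} → (Fin k → Bool) → ℕ
count f = sum (𝟙 ∘ f)

sum-ones : ∀ k → sum {k} (const 1) ≡ k
sum-ones zero = refl
sum-ones (suc k) = cong suc (sum-ones k)

sum-zero : ∀ {k} {f : Fin k → ℕ} → (∀ i → f i ≡ 0) → sum f ≡ 0
sum-zero {zero} _ = refl
sum-zero {suc k} f≗0 = cong₂ _+_ (f≗0 zero) (sum-zero (f≗0 ∘ suc))

sum-mono-≤ : ∀ {k} {f g : Fin k → ℕ} → (∀ i → f i ≤ g i) → sum f ≤ sum g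
sum-mono-≤ {zero} _ = z≤n
sum-mono-≤ {suc k} f≤g = +-mono-≤ (f≤g zero) (sum-mono-≤ (f≤g ∘ suc))

sum-split-at : ∀ {k} (f : Fin k → ℕ) a → sum f ≡ f a + sum (updateAt f a (const 0))
sum-split-at f zero = refl
sum-split-at f (suc a) = begin
  f zero + sum (f ∘ suc)                                       ≡⟨ cong (f zero +_) (sum-split-at (f ∘ suc) a) ⟩
  f zero + (f (suc a) + sum (updateAt (f ∘ suc) a (const 0)))  ≡⟨ x∙yz≈y∙xz (f zero) (f (suc a)) _ ⟩
  f (suc a) + (f zero + sum (updateAt (f ∘ suc) a (const 0)))  ∎
  where open ≡-Reasoning

sum-≥ : ∀ {k} (f : Fin k → ℕ) a → f a ≤ sum f
sum-≥ f a = subst (f a ≤_) (sym (sum-split-at f a)) (m≤m+n _ _)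

sum≢0⇒∃ : ∀ {k} (f : Fin k → ℕ) → 1 ≤ sum f → Σ (Fin k) λ i → f i ≢ 0
sum≢0⇒∃ {suc k} f h with f zero in e
... | suc _ = zero , λ f0≡0 → 0≢1+n (trans (sym f0≡0) e)
... | zero = let i , fi≢0 = sum≢0⇒∃ (f ∘ suc) h in suc i , fi≢0

count≢0⇒∃ : ∀ {k} (f : Fin k → Bool) → 1 ≤ count f → Σ (Fin k) λ i → f i ≡ true
count≢0⇒∃ f h = let i , fi≢0 = sum≢0⇒∃ (𝟙 ∘ f) h in i , 𝟙≢0⇒true fi≢0

count≡1 : ∀ {k} (f : Fin k → Bool) a → f a ≡ true → (∀ v → v ≢ a → f v ≡ false) → count f ≡ 1
count≡1 f a fa others = begin
  count f                                           ≡⟨ sum-split-at (𝟙 ∘ f) a ⟩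
  𝟙 (f a) + sum (updateAt (𝟙 ∘ f) a (const 0))      ≡⟨ cong₂ _+_ (cong 𝟙 fa) (sum-zero rest≡0) ⟩
  1                                                 ∎
  where
  open ≡-Reasoning
  rest≡0 : ∀ v → updateAt (𝟙 ∘ f) a (const 0) v ≡ 0
  rest≡0 v with v ≟ a
  ... | yes refl = updateAt-updates a (𝟙 ∘ f)
  ... | no v≢a = trans (updateAt-minimal v a (𝟙 ∘ f) v≢a) (cong 𝟙 (others v v≢a))

count≥2 : ∀ {k} (f : Fin k → Bool) a b → f a ≡ true → f b ≡ true → a ≢ b → 2 ≤ count f
count≥2 f a b fa fb a≢b = begin
  2                ≤⟨ +-mono-≤ (≤-reflexive (cong 𝟙 (sym fa))) rest≥1 ⟩
  𝟙 (f a) + sum g  ≡⟨ sum-split-at (𝟙 ∘ f) a ⟨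
  count f          ∎
  where
  open ≤-Reasoning
  g = updateAt (𝟙 ∘ f) a (const 0)
  rest≥1 : 1 ≤ sum g
  rest≥1 = subst (_≤ sum g) (trans (updateAt-minimal b a (𝟙 ∘ f) (a≢b ∘ sym)) (cong 𝟙 fb)) (sum-≥ g b)

count≥2⇒∃≢ : ∀ {k} (f : Fin k → Bool) → 2 ≤ count f → ∀ a → Σ (Fin k) λ u → u ≢ a × f u ≡ true
count≥2⇒∃≢ f h a = u , u≢a , 𝟙≢0⇒true (λ fu≡0 → gu≢0 (trans (updateAt-minimal u a (𝟙 ∘ f) u≢a) fu≡0))
  where
  g = updateAt (𝟙 ∘ f) a (const 0)
  sum-g≥1 : 1 ≤ sum g
  sum-g≥1 = +-cancelˡ-≤ 1 1 _ (≤-trans (subst (2 ≤_) (sum-split-at (𝟙 ∘ f) a) h) (+-monoˡ-≤ _ (𝟙≤1 (f a))))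
  u = proj₁ (sum≢0⇒∃ g sum-g≥1)
  gu≢0 = proj₂ (sum≢0⇒∃ g sum-g≥1)
  u≢a : u ≢ a
  u≢a u≡a = gu≢0 (subst (λ v → g v ≡ 0) (sym u≡a) (updateAt-updates a (𝟙 ∘ f)))

sum-over-pairs : ∀ {n} m (a b : Fin m → Fin n) →
  (∀ j k → a j ≡ a k → j ≡ k) → (∀ j k → b j ≡ b k → j ≡ k) → (∀ j k → a j ≢ b k) →
  (f : Fin n → ℕ) → (∀ v → (∀ j → v ≢ a j × v ≢ b j) → f v ≡ 0) →
  sum f ≡ sum (λ j → f (a j) + f (b j))
sum-over-pairs zero a b _ _ _ f f-supp = sum-zero (λ v → f-supp v (λ ()))
sum-over-pairs (suc m) a b a-inj b-inj a≢b f f-supp = begin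
  sum f                                                     ≡⟨ sum-split-at f a₀ ⟩
  f a₀ + sum f₁                                             ≡⟨ cong (f a₀ +_) (sum-split-at f₁ b₀) ⟩
  f a₀ + (f₁ b₀ + sum f₂)                                   ≡⟨ cong (λ x → f a₀ + (x + sum f₂)) (updateAt-minimal b₀ a₀ f (a≢b zero zero ∘ sym)) ⟩
  f a₀ + (f b₀ + sum f₂)                                    ≡⟨ +-assoc (f a₀) (f b₀) _ ⟨
  f a₀ + f b₀ + sum f₂                                      ≡⟨ cong (f a₀ + f b₀ +_) rest ⟩
  f a₀ + f b₀ + sum (λ j → f (a (suc j)) + f (b (suc j)))   ∎
  where
  open ≡-Reasoning
  a₀ = a zero
  b₀ = b zero
  f₁ = updateAt f a₀ (const 0)
  f₂ = updateAt f₁ b₀ (const 0)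
  f₂≡f : ∀ v → v ≢ a₀ → v ≢ b₀ → f₂ v ≡ f v
  f₂≡f v v≢a₀ v≢b₀ = trans (updateAt-minimal v b₀ f₁ v≢b₀) (updateAt-minimal v a₀ f v≢a₀)
  f₂-supp : ∀ v → (∀ j → v ≢ a (suc j) × v ≢ b (suc j)) → f₂ v ≡ 0
  f₂-supp v away with v ≟ b₀ | v ≟ a₀
  ... | yes refl | _ = updateAt-updates b₀ f₁
  ... | no v≢b₀ | yes refl = trans (updateAt-minimal _ b₀ f₁ v≢b₀) (updateAt-updates a₀ f)
  ... | no v≢b₀ | no v≢a₀ = trans (f₂≡f v v≢a₀ v≢b₀) (f-supp v λ { zero → v≢a₀ , v≢b₀ ; (suc j) → away j })
  rest : sum f₂ ≡ sum (λ j → f (a (suc j)) + f (b (suc j)))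
  rest = trans
    (sum-over-pairs m (a ∘ suc) (b ∘ suc) (λ j k → suc-injective ∘ a-inj _ _) (λ j k → suc-injective ∘ b-inj _ _)
      (λ j k → a≢b _ _) f₂ f₂-supp)
    (sum-cong-≗ λ j → cong₂ _+_
      (f₂≡f (a (suc j)) ((λ ()) ∘ a-inj _ _) (a≢b _ _))
      (f₂≡f (b (suc j)) (a≢b _ _ ∘ sym) ((λ ()) ∘ b-inj _ _)))

∣p∣≡count : ∀ {k} (p : Subset k) → ∣ p ∣ ≡ count (lookup p)
∣p∣≡count [] = refl
∣p∣≡count (true ∷ p) = cong suc (∣p∣≡count p)
∣p∣≡count (false ∷ p) = ∣p∣≡count p

∣tabulate∣≡count : ∀ {k} (f : Fin k → Bool) → ∣ tabulate f ∣ ≡ count f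
∣tabulate∣≡count f = trans (∣p∣≡count (tabulate f)) (sum-cong-≗ (cong 𝟙 ∘ lookup∘tabulate f))

∉⇒lookup≡false : ∀ {k} {p : Subset k} {x} → x ∉ p → lookup p x ≡ false
∉⇒lookup≡false {p = p} {x} x∉p = ¬-not (x∉p ∘ lookup⇒[]= x p)

lookup≡false⇒∉ : ∀ {k} {p : Subset k} {x} → lookup p x ≡ false → x ∉ p
lookup≡false⇒∉ e x∈p = true≢false (trans (sym ([]=⇒lookup x∈p)) e)

lookup-∩ : ∀ {k} (p q : Subset k) v → lookup (p ∩ q) v ≡ lookup p v ∧ lookup q v
lookup-∩ p q v = lookup-zipWith _∧_ v p q

lookup-∁ : ∀ {k} (p : Subset k) v → lookup (∁ p) v ≡ not (lookup p v)
lookup-∁ p v = lookup-map v not p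

-- Vertex covers

module GraphProperties {n : ℕ} (G : Graph n) where
  open Graph G using (adj; irref)

  anyᶠ-true⁻ : ∀ {k} (f : Fin k → Bool) → anyᶠ G f ≡ true → Σ (Fin k) λ i → f i ≡ true
  anyᶠ-true⁻ {suc k} f e with ∨-true⁻ {f zero} e
  ... | inj₁ f0 = zero , f0
  ... | inj₂ rest = let i , fi = anyᶠ-true⁻ (f ∘ suc) rest in suc i , fi

  anyᶠ-true⁺ : ∀ {k} (f : Fin k → Bool) i → f i ≡ true → anyᶠ G f ≡ true
  anyᶠ-true⁺ f zero fi rewrite fi = refl
  anyᶠ-true⁺ f (suc i) fi with f zero
  ... | true = refl
  ... | false = anyᶠ-true⁺ (f ∘ suc) i fi

  anyᶠ-false : ∀ {k} (f : Fin k → Bool) → (∀ i → f i ≡ false) → anyᶠ G f ≡ false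
  anyᶠ-false {zero} f _ = refl
  anyᶠ-false {suc k} f f≗false rewrite f≗false zero = anyᶠ-false (f ∘ suc) (f≗false ∘ suc)

  adj-sym : ∀ u v → adj u v ≡ true → adj v u ≡ true
  adj-sym u v e = trans (sym (Graph.sym G u v)) e

  adj⇒≢ : ∀ u v → adj u v ≡ true → u ≢ v
  adj⇒≢ u .u e refl = true≢false (trans (sym e) (irref u))

  deg≡count : ∀ x → deg G x ≡ count (adj x)
  deg≡count x = ∣tabulate∣≡count (adj x)

  lookup-NS : ∀ U y → lookup (NS G U) y ≡ anyᶠ G (λ x → lookup U x ∧ adj x y)
  lookup-NS U y = lookup∘tabulate _ y

  lookup-NS[] : ∀ U y → lookup (NS[] G U) y ≡ lookup U y ∨ lookup (NS G U) y
  lookup-NS[] U y = lookup-zipWith _∨_ y U (NS G U)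

  degOut≡count : ∀ U x → degOut G U x ≡ count (λ v → adj x v ∧ not (lookup (NS[] G U) v))
  degOut≡count U x = trans (∣p∣≡count (N G x ∩ ∁ (NS[] G U))) (sum-cong-≗ λ v → cong 𝟙
    (trans (lookup-∩ (N G x) (∁ (NS[] G U)) v) (cong₂ _∧_ (lookup∘tabulate (adj x) v) (lookup-∁ (NS[] G U) v))))

  HasOutsideNeighbours : Subset n → Set
  HasOutsideNeighbours C = ∀ {v} → v ∈ C → Σ (Fin n) λ u → Edge G v u × u ∉ C

  outsideNeighbours⇒minimal : ∀ C → IsVertexCover G C → HasOutsideNeighbours C → IsMinimalVertexCover G C
  outsideNeighbours⇒minimal C C-cover C-outside = C-cover , λ D D⊆C D-cover → ⊆-antisym D⊆C (C⊆D D⊆C D-cover)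
    where
    C⊆D : ∀ {D} → D ⊆ C → IsVertexCover G D → C ⊆ D
    C⊆D D⊆C D-cover v∈C with C-outside v∈C
    ... | u , vu , u∉C with D-cover _ u vu
    ...   | inj₁ v∈D = v∈D
    ...   | inj₂ u∈D = contradiction (D⊆C u∈D) u∉C

  minimal⇒outsideNeighbours : ∀ C → IsMinimalVertexCover G C → HasOutsideNeighbours C
  minimal⇒outsideNeighbours C (C-cover , C-minimal) {x} x∈C
    with any? (λ u → (adj x u ≟ᵇ true) ×-dec ¬? (u ∈? C))
  ... | yes (u , xu , u∉C) = u , xu , u∉C
  ... | no no-outside = contradiction (subst (x ∈_) (sym C-x≡C) x∈C) x∉C-x
    where
    nbr∈C : ∀ {u} → Edge G x u → u ∈ C
    nbr∈C {u} xu with u ∈? C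
    ... | yes u∈C = u∈C
    ... | no u∉C = contradiction (u , xu , u∉C) no-outside
    keep : ∀ {u} → u ∈ C → u ≢ x → u ∈ C - x
    keep = x∈p∧x≢y⇒x∈p-y
    C-x-cover : IsVertexCover G (C - x)
    C-x-cover u v uv with u ≟ x | v ≟ x
    ... | yes refl | yes refl = contradiction refl (adj⇒≢ u u uv)
    ... | yes refl | no v≢x = inj₂ (keep (nbr∈C uv) v≢x)
    ... | no u≢x | yes refl = inj₁ (keep (nbr∈C (adj-sym u x uv)) u≢x)
    ... | no u≢x | no v≢x with C-cover u v uv
    ...   | inj₁ u∈C = inj₁ (keep u∈C u≢x)
    ...   | inj₂ v∈C = inj₂ (keep v∈C v≢x)
    C-x≡C : C - x ≡ C
    C-x≡C = C-minimal (C - x) (p─q⊆p C _) C-x-cover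
    x∉C-x : x ∉ C - x
    x∉C-x x∈C-x with x∈p⇒p-x⊂p x∈C
    ... | _ , y , y∈C , y∉C-x = y∉C-x (subst (y ∈_) (sym C-x≡C) y∈C)

-- Covers from an admissible decomposition

_=ᶠ_ : ∀ {k} → Fin k → Fin k → Bool
a =ᶠ b = does (a ≟ b)

=ᶠ-true⁻ : ∀ {k} {a b : Fin k} → a =ᶠ b ≡ true → a ≡ b
=ᶠ-true⁻ {a = a} {b} e with a ≟ b
... | yes a≡b = a≡b

=ᶠ-refl : ∀ {k} (a : Fin k) → a =ᶠ a ≡ true
=ᶠ-refl a = dec-true (a ≟ a) refl

data Pick : Set where
  pick₁ pick₂ skip : Pick

picks₁ picks₂ skips : Pick → Bool
picks₁ pick₁ = true
picks₁ _ = false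
picks₂ pick₂ = true
picks₂ _ = false
skips skip = true
skips _ = false

-- The pick on an edge {x₁, x₂} of G_M from a = [x₁ ∈ M₂], b = [x₂ ∈ M₂], k = [the edge is counted by m₂′]
-- and d = [deg′ x₁ ≥ 2]: the vertex in M₂, else nothing on counted edges, else a vertex with deg′ ≤ 1.
choose : Bool → Bool → Bool → Bool → Pick
choose true _ _ _ = pick₁
choose false true _ _ = pick₂
choose false false true _ = skip
choose false false false true = pick₂
choose false false false false = pick₁

choose-picks₁ : ∀ {a} b k d → a ≡ true → picks₁ (choose a b k d) ≡ true
choose-picks₁ _ _ _ refl = refl

choose-picks₂ : ∀ {a b} k d → a ≡ false → b ≡ true → picks₂ (choose a b k d) ≡ true
choose-picks₂ _ _ refl refl = refl

choose-skips : ∀ a b k d → (a ≡ true → k ≡ false) → (b ≡ true → k ≡ false) → skips (choose a b k d) ≡ k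
choose-skips true _ _ _ a⇒¬k _ = sym (a⇒¬k refl)
choose-skips false true _ _ _ b⇒¬k = sym (b⇒¬k refl)
choose-skips false false true _ _ _ = refl
choose-skips false false false true _ _ = refl
choose-skips false false false false _ _ = refl

choose-pick₁ : ∀ a b k d → picks₁ (choose a b k d) ≡ true → a ≡ false → b ≡ false × k ≡ false × d ≡ false
choose-pick₁ false false false false _ _ = refl , refl , refl
choose-pick₁ false true _ _ () _
choose-pick₁ false false true _ () _
choose-pick₁ false false false true () _

choose-pick₂ : ∀ a b k d → picks₂ (choose a b k d) ≡ true → b ≡ false → a ≡ false × k ≡ false × d ≡ true
choose-pick₂ false false false true _ _ = refl , refl , refl
choose-pick₂ true _ _ _ () _
choose-pick₂ false false true _ () _
choose-pick₂ false false false false () _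

one-pick : ∀ p → 𝟙 (picks₁ p) + 𝟙 (picks₂ p) + 𝟙 (skips p) ≡ 1
one-pick pick₁ = refl
one-pick pick₂ = refl
one-pick skip = refl

pointwise-bound : ∀ w s a b i → (s ≡ true → a ≡ true) → (s ≡ true → b ≡ true) →
                  (w ≡ true → s ≡ false → a ≡ true ⊎ b ≡ true ⊎ i ≡ true) →
                  𝟙 w + 𝟙 s ≤ 𝟙 a + 𝟙 b + 𝟙 i
pointwise-bound w true a b i s⇒a s⇒b _ rewrite s⇒a refl | s⇒b refl = ≤-trans (+-monoˡ-≤ 1 (𝟙≤1 w)) (m≤m+n 2 (𝟙 i))
pointwise-bound false false a b i _ _ _ = z≤n
pointwise-bound true false a b i _ _ escape with escape refl refl
... | inj₁ refl = s≤s z≤n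
... | inj₂ (inj₁ refl) = ≤-trans (m≤n+m 1 (𝟙 a)) (m≤m+n (𝟙 a + 1) (𝟙 i))
... | inj₂ (inj₂ refl) = m≤n+m 1 (𝟙 a + 𝟙 b)

exactly-one : ∀ a b k → (a ≡ true → k ≡ false) → (b ≡ true → k ≡ false) → (a ≡ true → b ≡ false) →
              (a ≡ false → b ≡ false → k ≡ true) → 𝟙 a + 𝟙 b + 𝟙 k ≡ 1
exactly-one true true _ _ _ a⇒¬b _ = contradiction (a⇒¬b refl) true≢false
exactly-one true false k a⇒¬k _ _ _ rewrite a⇒¬k refl = refl
exactly-one false true k _ b⇒¬k _ _ rewrite b⇒¬k refl = refl
exactly-one false false k _ _ _ neither rewrite neither refl refl = refl

module Decomposition {n : ℕ} {G : Graph n} (D : AdmDec G) where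
  open Graph G using (adj)
  open AdmDec D
  open GraphProperties G

  inW : Fin n → Bool
  inW = lookup W

  ∉W⇒∈M : ∀ {v} → inW v ≡ false → v ∈ M
  ∉W⇒∈M {v} e = lookup⇒[]= v M (trans (lookup-∁ W v) (cong not e))

  ∈M⇒∉W : ∀ {v} → v ∈ M → inW v ≡ false
  ∈M⇒∉W {v} v∈M = not-true⁻ (trans (sym (lookup-∁ W v)) ([]=⇒lookup v∈M))

  ∉W⇒InPairs : ∀ v → inW v ≡ false → InPairs v
  ∉W⇒InPairs v e = M-pairs v (∉W⇒∈M e)

  InPairs⇒∉W : ∀ v → InPairs v → inW v ≡ false
  InPairs⇒∉W v p = ∈M⇒∉W (pairs-M v p)

  x₁∉W : ∀ j → inW (x₁ j) ≡ false
  x₁∉W j = InPairs⇒∉W (x₁ j) (j , inj₁ refl)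

  x₂∉W : ∀ j → inW (x₂ j) ≡ false
  x₂∉W j = InPairs⇒∉W (x₂ j) (j , inj₂ refl)

  W-nonadjacent : ∀ u v → inW u ≡ true → inW v ≡ true → adj u v ≡ false
  W-nonadjacent u v u∈W v∈W = ¬-not (W-indep u v (lookup⇒[]= u W u∈W) (lookup⇒[]= v W v∈W))

  W-neighbour∉W : ∀ u v → inW u ≡ true → adj u v ≡ true → inW v ≡ false
  W-neighbour∉W u v u∈W uv = ¬-not λ v∈W → true≢false (trans (sym uv) (W-nonadjacent u v u∈W v∈W))

  pair-edge-sym : ∀ j → adj (x₂ j) (x₁ j) ≡ true
  pair-edge-sym j = adj-sym _ _ (pair-edge j)

  partner₁ : ∀ j v → adj (x₁ j) v ≡ true → inW v ≡ false → v ≡ x₂ j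
  partner₁ j v e v∉W with M-induced (x₁ j) v (∉W⇒∈M (x₁∉W j)) (∉W⇒∈M v∉W) e
  ... | k , inj₁ (x₁j≡x₁k , v≡x₂k) = trans v≡x₂k (cong x₂ (sym (x₁-inj j k x₁j≡x₁k)))
  ... | k , inj₂ (x₁j≡x₂k , _) = contradiction x₁j≡x₂k (x₁≢x₂ j k)

  partner₂ : ∀ j v → adj (x₂ j) v ≡ true → inW v ≡ false → v ≡ x₁ j
  partner₂ j v e v∉W with M-induced (x₂ j) v (∉W⇒∈M (x₂∉W j)) (∉W⇒∈M v∉W) e
  ... | k , inj₁ (x₂j≡x₁k , _) = contradiction (sym x₂j≡x₁k) (x₁≢x₂ k j)
  ... | k , inj₂ (x₂j≡x₂k , v≡x₁k) = trans v≡x₁k (cong x₁ (sym (x₂-inj j k x₂j≡x₂k)))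

  sum-over-M : (f : Fin n → ℕ) → (∀ v → inW v ≡ true → f v ≡ 0) → sum f ≡ sum (λ j → f (x₁ j) + f (x₂ j))
  sum-over-M f f-supp = sum-over-pairs m x₁ x₂ x₁-inj x₂-inj x₁≢x₂ f supp
    where
    supp : ∀ v → (∀ j → v ≢ x₁ j × v ≢ x₂ j) → f v ≡ 0
    supp v away with inW v in e
    ... | true = f-supp v e
    ... | false with ∉W⇒InPairs v e
    ...   | j , inj₁ v≡x₁ = contradiction v≡x₁ (proj₁ (away j))
    ...   | j , inj₂ v≡x₂ = contradiction v≡x₂ (proj₂ (away j))

  #M : ℕ
  #M = count (not ∘ inW)

  module Transversal (T : Fin n → Bool) (T⊆M : ∀ v → T v ≡ true → inW v ≡ false)
                     (T-oneSided : ∀ j → T (x₁ j) ≡ true → T (x₂ j) ≡ false) where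

    inN : Fin n → Bool
    inN v = anyᶠ G (λ t → T t ∧ adj t v)

    inN-intro : ∀ t v → T t ≡ true → adj t v ≡ true → inN v ≡ true
    inN-intro t v tT tv = anyᶠ-true⁺ _ t (∧-true⁺ tT tv)

    inN-elim : ∀ v → inN v ≡ true → Σ (Fin n) λ t → T t ≡ true × adj t v ≡ true
    inN-elim v e = let t , p = anyᶠ-true⁻ _ e in t , ∧-true⁻ p

    inC : Fin n → Bool
    inC v = if inW v then inN v else not (T v)

    C : Subset n
    C = tabulate inC

    inC-W : ∀ v → inW v ≡ true → inC v ≡ inN v
    inC-W v v∈W = cong (λ b → if b then inN v else not (T v)) v∈W

    inC-M : ∀ v → inW v ≡ false → inC v ≡ not (T v)
    inC-M v v∉W = cong (λ b → if b then inN v else not (T v)) v∉W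

    #W∩N : ℕ
    #W∩N = count (λ v → inW v ∧ inN v)

    T∩W≡false : ∀ v → inW v ≡ true → T v ≡ false
    T∩W≡false v v∈W = ¬-not λ tT → true≢false (trans (sym v∈W) (T⊆M v tT))

    inC-T : ∀ v → T v ≡ true → inC v ≡ false
    inC-T v tT = trans (inC-M v (T⊆M v tT)) (cong not tT)

    M-edge-oneSided : ∀ u v → inW u ≡ false → inW v ≡ false → adj u v ≡ true → T u ≡ false ⊎ T v ≡ false
    M-edge-oneSided u v u∉W v∉W uv with T u in tu | M-induced u v (∉W⇒∈M u∉W) (∉W⇒∈M v∉W) uv
    ... | false | _ = inj₁ refl
    ... | true | j , inj₁ (refl , refl) = inj₂ (T-oneSided j tu)
    ... | true | j , inj₂ (refl , refl) with T (x₁ j) in t₁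
    ...   | false = inj₂ refl
    ...   | true = contradiction (trans (sym tu) (T-oneSided j t₁)) true≢false

    inC-cover : ∀ u v → adj u v ≡ true → inC u ≡ true ⊎ inC v ≡ true
    inC-cover u v uv with inW u in u∈W | inW v in v∈W
    ... | true | true = contradiction (trans (sym uv) (W-nonadjacent u v u∈W v∈W)) true≢false
    ... | true | false with T v in tv
    ...   | true = inj₁ (inN-intro v u tv (adj-sym u v uv))
    ...   | false = inj₂ refl
    inC-cover u v uv | false | true with T u in tu
    ...   | true = inj₂ (inN-intro u v tu uv)
    ...   | false = inj₁ refl
    inC-cover u v uv | false | false with M-edge-oneSided u v u∈W v∈W uv
    ...   | inj₁ tu = inj₁ (cong not tu)
    ...   | inj₂ tv = inj₂ (cong not tv)

    C-cover : IsVertexCover G C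
    C-cover u v uv with inC-cover u v uv
    ... | inj₁ u∈C = inj₁ (lookup⇒[]= u C (trans (lookup∘tabulate inC u) u∈C))
    ... | inj₂ v∈C = inj₂ (lookup⇒[]= v C (trans (lookup∘tabulate inC v) v∈C))

    ∣C∣+∣T∣ : ∣ C ∣ + count T ≡ #M + #W∩N
    ∣C∣+∣T∣ = begin
      ∣ C ∣ + count T                                   ≡⟨ cong (_+ count T) (∣tabulate∣≡count inC) ⟩
      count inC + count T                               ≡⟨ ∑-distrib-+ (𝟙 ∘ inC) (𝟙 ∘ T) ⟨
      sum (λ v → 𝟙 (inC v) + 𝟙 (T v))                   ≡⟨ sum-cong-≗ pointwise ⟩
      sum (λ v → 𝟙 (not (inW v)) + 𝟙 (inW v ∧ inN v))   ≡⟨ ∑-distrib-+ (𝟙 ∘ not ∘ inW) _ ⟩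
      #M + #W∩N                                         ∎
      where
      open ≡-Reasoning
      pointwise : ∀ v → 𝟙 (inC v) + 𝟙 (T v) ≡ 𝟙 (not (inW v)) + 𝟙 (inW v ∧ inN v)
      pointwise v with inW v in v∈W
      ... | true rewrite T∩W≡false v v∈W = +-identityʳ _
      ... | false with T v
      ...   | true = refl
      ...   | false = refl

    ∣C∣+m : (k : Fin m → Bool) → (∀ j → 𝟙 (T (x₁ j)) + 𝟙 (T (x₂ j)) + 𝟙 (k j) ≡ 1) →
            ∣ C ∣ + m ≡ #M + #W∩N + count k
    ∣C∣+m k one-per-pair = begin
      ∣ C ∣ + m                                                ≡⟨ cong (∣ C ∣ +_) m≡ ⟨
      ∣ C ∣ + (sum (λ j → 𝟙 (T (x₁ j)) + 𝟙 (T (x₂ j))) + count k)  ≡⟨ cong (λ x → ∣ C ∣ + (x + count k)) ∣T∣≡ ⟨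
      ∣ C ∣ + (count T + count k)                              ≡⟨ +-assoc ∣ C ∣ _ _ ⟨
      ∣ C ∣ + count T + count k                                ≡⟨ cong (_+ count k) ∣C∣+∣T∣ ⟩
      #M + #W∩N + count k                                      ∎
      where
      open ≡-Reasoning
      ∣T∣≡ : count T ≡ sum (λ j → 𝟙 (T (x₁ j)) + 𝟙 (T (x₂ j)))
      ∣T∣≡ = sum-over-M (𝟙 ∘ T) (λ v v∈W → cong 𝟙 (T∩W≡false v v∈W))
      m≡ : sum (λ j → 𝟙 (T (x₁ j)) + 𝟙 (T (x₂ j))) + count k ≡ m
      m≡ = trans (sym (∑-distrib-+ _ (𝟙 ∘ k))) (trans (sum-cong-≗ one-per-pair) (sum-ones m))

    UncoveredPairsHaveOutsideNeighbours : Set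
    UncoveredPairsHaveOutsideNeighbours = ∀ j → T (x₁ j) ≡ false → T (x₂ j) ≡ false →
      (Σ (Fin n) λ u → inW u ≡ true × adj (x₁ j) u ≡ true × inN u ≡ false) ×
      (Σ (Fin n) λ u → inW u ≡ true × adj (x₂ j) u ≡ true × inN u ≡ false)

    C-minimal : UncoveredPairsHaveOutsideNeighbours → IsMinimalVertexCover G C
    C-minimal outside = outsideNeighbours⇒minimal C C-cover λ {v} v∈C →
      let u , vu , u∉C = witness v (trans (sym (lookup∘tabulate inC v)) ([]=⇒lookup v∈C)) in
      u , vu , λ u∈C → true≢false (trans (sym ([]=⇒lookup u∈C)) (trans (lookup∘tabulate inC u) u∉C))
      where
      witness : ∀ v → inC v ≡ true → Σ (Fin n) λ u → adj v u ≡ true × inC u ≡ false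
      witness v v∈C with inW v in v∈W
      ... | true = let t , tT , tv = inN-elim v v∈C in t , adj-sym t v tv , inC-T t tT
      ... | false with ∉W⇒InPairs v v∈W
      ...   | j , inj₁ refl with T (x₂ j) in t₂
      ...     | true = x₂ j , pair-edge j , inC-T (x₂ j) t₂
      ...     | false = let u , u∈W , vu , u∉N = proj₁ (outside j (not-true⁻ v∈C) t₂) in u , vu , trans (inC-W u u∈W) u∉N
      witness v v∈C | false | j , inj₂ refl with T (x₁ j) in t₁
      ...     | true = x₁ j , pair-edge-sym j , inC-T (x₁ j) t₁
      ...     | false = let u , u∈W , vu , u∉N = proj₂ (outside j t₁ (not-true⁻ v∈C)) in u , vu , trans (inC-W u u∈W) u∉N

  module Picks (c : Fin m → Pick) where

    T : Fin n → Bool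
    T v = anyᶠ G (λ j → (x₁ j =ᶠ v ∧ picks₁ (c j)) ∨ (x₂ j =ᶠ v ∧ picks₂ (c j)))

    T-x₁ : ∀ k → T (x₁ k) ≡ picks₁ (c k)
    T-x₁ k = bool-ext to (λ e → anyᶠ-true⁺ _ k (∨-true⁺ˡ (∧-true⁺ (=ᶠ-refl (x₁ k)) e)))
      where
      to : T (x₁ k) ≡ true → picks₁ (c k) ≡ true
      to e with anyᶠ-true⁻ _ e
      ... | j , p with ∨-true⁻ {x₁ j =ᶠ x₁ k ∧ picks₁ (c j)} p
      ...   | inj₁ q = let x₁j≡x₁k , pj = ∧-true⁻ q in subst (λ i → picks₁ (c i) ≡ true) (x₁-inj j k (=ᶠ-true⁻ x₁j≡x₁k)) pj
      ...   | inj₂ q = contradiction (sym (=ᶠ-true⁻ (proj₁ (∧-true⁻ q)))) (x₁≢x₂ k j)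

    T-x₂ : ∀ k → T (x₂ k) ≡ picks₂ (c k)
    T-x₂ k = bool-ext to (λ e → anyᶠ-true⁺ _ k (∨-true⁺ʳ (∧-true⁺ (=ᶠ-refl (x₂ k)) e)))
      where
      to : T (x₂ k) ≡ true → picks₂ (c k) ≡ true
      to e with anyᶠ-true⁻ _ e
      ... | j , p with ∨-true⁻ {x₁ j =ᶠ x₂ k ∧ picks₁ (c j)} p
      ...   | inj₁ q = contradiction (=ᶠ-true⁻ (proj₁ (∧-true⁻ q))) (x₁≢x₂ j k)
      ...   | inj₂ q = let x₂j≡x₂k , pj = ∧-true⁻ q in subst (λ i → picks₂ (c i) ≡ true) (x₂-inj j k (=ᶠ-true⁻ x₂j≡x₂k)) pj

    T⊆M : ∀ v → T v ≡ true → inW v ≡ false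
    T⊆M v e with anyᶠ-true⁻ _ e
    ... | j , p with ∨-true⁻ {x₁ j =ᶠ v ∧ picks₁ (c j)} p
    ...   | inj₁ q = InPairs⇒∉W v (j , inj₁ (sym (=ᶠ-true⁻ (proj₁ (∧-true⁻ q)))))
    ...   | inj₂ q = InPairs⇒∉W v (j , inj₂ (sym (=ᶠ-true⁻ (proj₁ (∧-true⁻ q)))))

    T-oneSided : ∀ j → T (x₁ j) ≡ true → T (x₂ j) ≡ false
    T-oneSided j e = trans (T-x₂ j) (oneSided (c j) (trans (sym (T-x₁ j)) e))
      where
      oneSided : ∀ p → picks₁ p ≡ true → picks₂ p ≡ false
      oneSided pick₁ _ = refl

    open Transversal T T⊆M T-oneSided public

    ∣C∣+m-picks : ∣ C ∣ + m ≡ #M + #W∩N + count (skips ∘ c)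
    ∣C∣+m-picks = ∣C∣+m (skips ∘ c) λ j → trans (cong₂ (λ a b → 𝟙 a + 𝟙 b + _) (T-x₁ j) (T-x₂ j)) (one-pick (c j))

    unpicked⇒skip : ∀ j → T (x₁ j) ≡ false → T (x₂ j) ≡ false → skips (c j) ≡ true
    unpicked⇒skip j t₁ t₂ = neither (c j) (trans (sym (T-x₁ j)) t₁) (trans (sym (T-x₂ j)) t₂)
      where
      neither : ∀ p → picks₁ p ≡ false → picks₂ p ≡ false → skips p ≡ true
      neither skip _ _ = refl

  module FullPicks (second : Fin m → Bool) where
    open Picks (λ j → if second j then pick₂ else pick₁) public

    never-skips : ∀ j → skips (if second j then pick₂ else pick₁) ≡ false
    never-skips j with second j
    ... | true = refl
    ... | false = refl

    ∣C∣+m-full : ∣ C ∣ + m ≡ #M + #W∩N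
    ∣C∣+m-full = trans ∣C∣+m-picks (trans (cong (#M + #W∩N +_) (sum-zero (cong 𝟙 ∘ never-skips))) (+-identityʳ _))

    C-minimal-full : IsMinimalVertexCover G C
    C-minimal-full = C-minimal λ j t₁ t₂ → ⊥-elim (true≢false (trans (sym (unpicked⇒skip j t₁ t₂)) (never-skips j)))

  module Deletion (M₂ : Subset n) (M₂⊆M : ∀ v → lookup M₂ v ≡ true → inW v ≡ false) where

    inM₂ : Fin n → Bool
    inM₂ = lookup M₂

    inN : Fin n → Bool
    inN = lookup (NS G M₂)

    inG′ : Fin n → Bool
    inG′ v = not (lookup (NS[] G M₂) v)

    inG′≡ : ∀ v → inG′ v ≡ not (inM₂ v ∨ inN v)
    inG′≡ v = cong not (lookup-NS[] M₂ v)

    M₂∩W≡false : ∀ v → inW v ≡ true → inM₂ v ≡ false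
    M₂∩W≡false v v∈W = ¬-not λ v∈M₂ → true≢false (trans (sym v∈W) (M₂⊆M v v∈M₂))

    inG′-W : ∀ v → inW v ≡ true → inG′ v ≡ not (inN v)
    inG′-W v v∈W = trans (inG′≡ v) (cong (λ b → not (b ∨ inN v)) (M₂∩W≡false v v∈W))

    inN-intro : ∀ x v → inM₂ x ≡ true → adj x v ≡ true → inN v ≡ true
    inN-intro x v x∈M₂ xv = trans (lookup-NS M₂ v) (anyᶠ-true⁺ _ x (∧-true⁺ x∈M₂ xv))

    inN-elim : ∀ v → inN v ≡ true → Σ (Fin n) λ x → inM₂ x ≡ true × adj x v ≡ true
    inN-elim v e = let x , p = anyᶠ-true⁻ _ (trans (sym (lookup-NS M₂ v)) e) in x , ∧-true⁻ p

    inN-x₁ : ∀ j → inN (x₁ j) ≡ inM₂ (x₂ j)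
    inN-x₁ j = bool-ext to (λ e → inN-intro (x₂ j) (x₁ j) e (pair-edge-sym j))
      where
      to : inN (x₁ j) ≡ true → inM₂ (x₂ j) ≡ true
      to e = let x , x∈M₂ , xv = inN-elim _ e in
             subst (λ y → inM₂ y ≡ true) (partner₁ j x (adj-sym x _ xv) (M₂⊆M x x∈M₂)) x∈M₂

    inN-x₂ : ∀ j → inN (x₂ j) ≡ inM₂ (x₁ j)
    inN-x₂ j = bool-ext to (λ e → inN-intro (x₁ j) (x₂ j) e (pair-edge j))
      where
      to : inN (x₂ j) ≡ true → inM₂ (x₁ j) ≡ true
      to e = let x , x∈M₂ , xv = inN-elim _ e in
             subst (λ y → inM₂ y ≡ true) (partner₂ j x (adj-sym x _ xv) (M₂⊆M x x∈M₂)) x∈M₂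

    inG′-x₁ : ∀ j → inG′ (x₁ j) ≡ not (inM₂ (x₁ j) ∨ inM₂ (x₂ j))
    inG′-x₁ j = trans (inG′≡ _) (cong (λ b → not (inM₂ (x₁ j) ∨ b)) (inN-x₁ j))

    inG′-x₂ : ∀ j → inG′ (x₂ j) ≡ not (inM₂ (x₂ j) ∨ inM₂ (x₁ j))
    inG′-x₂ j = trans (inG′≡ _) (cong (λ b → not (inM₂ (x₂ j) ∨ b)) (inN-x₂ j))

    #W∩N : ℕ
    #W∩N = count (λ v → inW v ∧ inN v)

    -- N(M₂) ∩ M is the set of partners of M₂
    ∣N[M₂]∣≡ : ∣ NS G M₂ ∣ ≡ ∣ M₂ ∣ + #W∩N
    ∣N[M₂]∣≡ = begin
      ∣ NS G M₂ ∣                                                    ≡⟨ ∣p∣≡count (NS G M₂) ⟩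
      count inN                                                      ≡⟨ sum-cong-≗ split ⟩
      sum (λ v → 𝟙 (not (inW v) ∧ inN v) + 𝟙 (inW v ∧ inN v))        ≡⟨ ∑-distrib-+ (λ v → 𝟙 (not (inW v) ∧ inN v)) _ ⟩
      sum (λ v → 𝟙 (not (inW v) ∧ inN v)) + #W∩N                     ≡⟨ cong (_+ #W∩N) M∩N≡ ⟩
      ∣ M₂ ∣ + #W∩N                                                  ∎
      where
      open ≡-Reasoning
      split : ∀ v → 𝟙 (inN v) ≡ 𝟙 (not (inW v) ∧ inN v) + 𝟙 (inW v ∧ inN v)
      split v with inW v
      ... | true = refl
      ... | false = sym (+-identityʳ _)
      M∩N≡ : sum (λ v → 𝟙 (not (inW v) ∧ inN v)) ≡ ∣ M₂ ∣
      M∩N≡ = begin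
        sum (λ v → 𝟙 (not (inW v) ∧ inN v))
          ≡⟨ sum-over-M _ (λ v v∈W → cong (λ b → 𝟙 (not b ∧ inN v)) v∈W) ⟩
        sum (λ j → 𝟙 (not (inW (x₁ j)) ∧ inN (x₁ j)) + 𝟙 (not (inW (x₂ j)) ∧ inN (x₂ j)))
          ≡⟨ sum-cong-≗ (λ j → cong₂ (λ a b → 𝟙 (not a ∧ inN (x₁ j)) + 𝟙 (not b ∧ inN (x₂ j))) (x₁∉W j) (x₂∉W j)) ⟩
        sum (λ j → 𝟙 (inN (x₁ j)) + 𝟙 (inN (x₂ j)))
          ≡⟨ sum-cong-≗ (λ j → trans (cong₂ (λ a b → 𝟙 a + 𝟙 b) (inN-x₁ j) (inN-x₂ j)) (+-comm (𝟙 (inM₂ (x₂ j))) _)) ⟩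
        sum (λ j → 𝟙 (inM₂ (x₁ j)) + 𝟙 (inM₂ (x₂ j)))
          ≡⟨ sum-over-M (𝟙 ∘ inM₂) (λ v v∈W → cong 𝟙 (M₂∩W≡false v v∈W)) ⟨
        count inM₂
          ≡⟨ ∣p∣≡count M₂ ⟨
        ∣ M₂ ∣
          ∎

    deg′ : Fin n → ℕ
    deg′ = degOut G M₂

    deg′≡count : ∀ x → deg′ x ≡ count (λ v → adj x v ∧ inG′ v)
    deg′≡count = degOut≡count M₂

    counted : Fin m → Bool
    counted j = inG′ (x₁ j) ∧ inG′ (x₂ j) ∧ (2 ≤ᵇ deg′ (x₁ j)) ∧ (2 ≤ᵇ deg′ (x₂ j))

    m₂′≡count : m₂′ M₂ ≡ count counted
    m₂′≡count = ∣tabulate∣≡count counted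

    deg′≥2 : ∀ y p u → adj y p ≡ true → inG′ p ≡ true → inW p ≡ false →
             adj y u ≡ true → inG′ u ≡ true → inW u ≡ true → 2 ≤ deg′ y
    deg′≥2 y p u yp p∈G′ p∉W yu u∈G′ u∈W = subst (2 ≤_) (sym (deg′≡count y))
      (count≥2 _ u p (∧-true⁺ yu u∈G′) (∧-true⁺ yp p∈G′) λ u≡p → true≢false (trans (sym u∈W) (trans (cong inW u≡p) p∉W)))

    deg′≥2⇒W-neighbour : ∀ y p → (∀ v → adj y v ≡ true → inW v ≡ false → v ≡ p) → 2 ≤ deg′ y →
                         Σ (Fin n) λ u → inW u ≡ true × adj y u ≡ true × inN u ≡ false
    deg′≥2⇒W-neighbour y p only-p deg′y≥2 with count≥2⇒∃≢ _ (subst (2 ≤_) (deg′≡count y) deg′y≥2) p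
    ... | u , u≢p , q with ∧-true⁻ {adj y u} q | inW u in u∈W
    ...   | yu , _ | false = contradiction (only-p u yu u∈W) u≢p
    ...   | yu , u∈G′ | true = u , u∈W , yu , not-injective (trans (sym (inG′-W u u∈W)) u∈G′)

    counted-elim : ∀ j → counted j ≡ true →
      inG′ (x₁ j) ≡ true × inG′ (x₂ j) ≡ true × 2 ≤ deg′ (x₁ j) × 2 ≤ deg′ (x₂ j)
    counted-elim j e with ∧-true⁻ {inG′ (x₁ j)} e
    ... | g₁ , e′ with ∧-true⁻ {inG′ (x₂ j)} e′
    ...   | g₂ , e″ with ∧-true⁻ {2 ≤ᵇ deg′ (x₁ j)} e″
    ...     | d₁ , d₂ = g₁ , g₂ , ≤ᵇ-true⁻ d₁ , ≤ᵇ-true⁻ d₂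

    M₂-x₁⇒¬counted : ∀ j → inM₂ (x₁ j) ≡ true → counted j ≡ false
    M₂-x₁⇒¬counted j a = cong (λ g → g ∧ inG′ (x₂ j) ∧ (2 ≤ᵇ deg′ (x₁ j)) ∧ (2 ≤ᵇ deg′ (x₂ j)))
                               (trans (inG′-x₁ j) (cong (λ b → not (b ∨ inM₂ (x₂ j))) a))

    M₂-x₂⇒¬counted : ∀ j → inM₂ (x₂ j) ≡ true → counted j ≡ false
    M₂-x₂⇒¬counted j b = trans (cong (λ g → inG′ (x₁ j) ∧ g ∧ (2 ≤ᵇ deg′ (x₁ j)) ∧ (2 ≤ᵇ deg′ (x₂ j)))
                                     (trans (inG′-x₂ j) (cong (λ c → not (c ∨ inM₂ (x₁ j))) b)))
                               (∧-zeroʳ (inG′ (x₁ j)))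

    -- A minimal cover whose W-part is W ∩ N(M₂), missing exactly the edges counted by m₂′.
    module CoverOfM₂ (exclusive : ∀ j → inM₂ (x₁ j) ≡ true → inM₂ (x₂ j) ≡ false) where

      pickR : Fin m → Pick
      pickR j = choose (inM₂ (x₁ j)) (inM₂ (x₂ j)) (counted j) (2 ≤ᵇ deg′ (x₁ j))

      module R = Picks pickR

      M₂⊆R : ∀ x → inM₂ x ≡ true → R.T x ≡ true
      M₂⊆R x x∈M₂ with ∉W⇒InPairs x (M₂⊆M x x∈M₂)
      ... | j , inj₁ refl = trans (R.T-x₁ j) (choose-picks₁ _ _ _ x∈M₂)
      ... | j , inj₂ refl = trans (R.T-x₂ j) (choose-picks₂ _ _ (¬-not λ a → true≢false (trans (sym x∈M₂) (exclusive j a))) x∈M₂)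

      -- a vertex of R outside M₂ has at most one neighbour in G′, its partner
      N[R]≡N[M₂]-on-W : ∀ u → inW u ≡ true → R.inN u ≡ inN u
      N[R]≡N[M₂]-on-W u u∈W = bool-ext to from
        where
        from : inN u ≡ true → R.inN u ≡ true
        from e = let x , x∈M₂ , xu = inN-elim u e in R.inN-intro x u (M₂⊆R x x∈M₂) xu
        u∈G′ : inN u ≡ false → inG′ u ≡ true
        u∈G′ e = trans (inG′-W u u∈W) (cong not e)
        to : R.inN u ≡ true → inN u ≡ true
        to e with R.inN-elim u e
        ... | t , tR , tu with ∉W⇒InPairs t (R.T⊆M t tR)
        ...   | j , inj₁ refl with inM₂ (x₁ j) in a
        ...     | true = inN-intro (x₁ j) u a tu
        ...     | false with choose-pick₁ _ _ _ _ (trans (sym (R.T-x₁ j)) tR) a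
        ...       | b , _ , d₁ = ¬-not λ e′ → true≢false (trans (sym (≤ᵇ-true⁺
                       (deg′≥2 (x₁ j) (x₂ j) u (pair-edge j) (trans (inG′-x₂ j) (cong₂ (λ p q → not (p ∨ q)) b a)) (x₂∉W j)
                               tu (u∈G′ e′) u∈W))) d₁)
        to e | t , tR , tu | j , inj₂ refl with inM₂ (x₂ j) in b
        ...     | true = inN-intro (x₂ j) u b tu
        ...     | false with choose-pick₂ _ _ _ _ (trans (sym (R.T-x₂ j)) tR) b
        ...       | a , k , d₁ = ¬-not λ e′ → true≢false (trans (sym (counted-j e′)) k)
          where
          x₁∈G′ = trans (inG′-x₁ j) (cong₂ (λ p q → not (p ∨ q)) a b)
          x₂∈G′ = trans (inG′-x₂ j) (cong₂ (λ p q → not (p ∨ q)) b a)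
          counted-j : inN u ≡ false → counted j ≡ true
          counted-j e′ = ∧-true⁺ x₁∈G′ (∧-true⁺ x₂∈G′ (∧-true⁺ d₁ (≤ᵇ-true⁺
            (deg′≥2 (x₂ j) (x₁ j) u (pair-edge-sym j) x₁∈G′ (x₁∉W j) tu (u∈G′ e′) u∈W))))

      skipsR : ∀ j → skips (pickR j) ≡ counted j
      skipsR j = choose-skips _ _ _ _ (M₂-x₁⇒¬counted j) (M₂-x₂⇒¬counted j)

      R-minimal : IsMinimalVertexCover G R.C
      R-minimal = R.C-minimal λ j t₁ t₂ →
        let _ , _ , d₁ , d₂ = counted-elim j (trans (sym (skipsR j)) (R.unpicked⇒skip j t₁ t₂))
            u₁ , u₁∈W , x₁u₁ , u₁∉N = deg′≥2⇒W-neighbour (x₁ j) (x₂ j) (partner₁ j) d₁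
            u₂ , u₂∈W , x₂u₂ , u₂∉N = deg′≥2⇒W-neighbour (x₂ j) (x₁ j) (partner₂ j) d₂
        in (u₁ , u₁∈W , x₁u₁ , trans (N[R]≡N[M₂]-on-W u₁ u₁∈W) u₁∉N) , (u₂ , u₂∈W , x₂u₂ , trans (N[R]≡N[M₂]-on-W u₂ u₂∈W) u₂∉N)

      ∣R∣+m : ∣ R.C ∣ + m ≡ #M + #W∩N + m₂′ M₂
      ∣R∣+m = trans R.∣C∣+m-picks (cong₂ (λ a b → #M + a + b) (sum-cong-≗ same-W-part)
                                      (trans (sum-cong-≗ (cong 𝟙 ∘ skipsR)) (sym m₂′≡count)))
        where
        same-W-part : ∀ v → 𝟙 (inW v ∧ R.inN v) ≡ 𝟙 (inW v ∧ inN v)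
        same-W-part v with inW v in v∈W
        ... | true = cong 𝟙 (N[R]≡N[M₂]-on-W v v∈W)
        ... | false = refl

  lookup-∅ : ∀ v → lookup (∅ {n}) v ≡ false
  lookup-∅ v = lookup-replicate v false

  module Deletion∅ = Deletion ∅ (λ v e → contradiction (trans (sym e) (lookup-∅ v)) true≢false)
  module C₀ = Deletion∅.CoverOfM₂ (λ j e → contradiction (trans (sym e) (lookup-∅ (x₁ j))) true≢false)

  ∣C₀∣+m : ∣ C₀.R.C ∣ + m ≡ #M + m₂
  ∣C₀∣+m = begin
    ∣ C₀.R.C ∣ + m      ≡⟨ C₀.∣R∣+m ⟩
    #M + #W∩N + m₂′ ∅   ≡⟨ cong₂ (λ a b → #M + a + b) #W∩N≡0 m₂′≡m₂ ⟩
    #M + 0 + m₂         ≡⟨ cong (_+ m₂) (+-identityʳ #M) ⟩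
    #M + m₂             ∎
    where
    open ≡-Reasoning
    open Deletion∅
    inN≡false : ∀ v → inN v ≡ false
    inN≡false v = trans (lookup-NS ∅ v) (anyᶠ-false _ (λ x → cong (_∧ adj x v) (lookup-∅ x)))
    inG′≡true : ∀ v → inG′ v ≡ true
    inG′≡true v = trans (inG′≡ v) (cong₂ (λ a b → not (a ∨ b)) (lookup-∅ v) (inN≡false v))
    deg′≡deg : ∀ x → deg′ x ≡ deg G x
    deg′≡deg x = trans (deg′≡count x) (trans (sum-cong-≗ λ v → cong 𝟙 (trans (cong (adj x v ∧_) (inG′≡true v)) (∧-identityʳ _)))
                                               (sym (deg≡count x)))
    #W∩N≡0 : #W∩N ≡ 0
    #W∩N≡0 = sum-zero λ v → cong 𝟙 (trans (cong (inW v ∧_) (inN≡false v)) (∧-zeroʳ _))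
    m₂′≡m₂ : m₂′ ∅ ≡ m₂
    m₂′≡m₂ = trans m₂′≡count (trans (sum-cong-≗ λ j → cong 𝟙 (trans
      (cong₂ (λ g₁ g₂ → g₁ ∧ g₂ ∧ (2 ≤ᵇ deg′ (x₁ j)) ∧ (2 ≤ᵇ deg′ (x₂ j))) (inG′≡true (x₁ j)) (inG′≡true (x₂ j)))
      (cong₂ (λ d₁ d₂ → (2 ≤ᵇ d₁) ∧ (2 ≤ᵇ d₂)) (deg′≡deg (x₁ j)) (deg′≡deg (x₂ j)))))
      (sym (∣tabulate∣≡count (λ j → (2 ≤ᵇ deg G (x₁ j)) ∧ (2 ≤ᵇ deg G (x₂ j))))))

  module Unmixed⇒Flat (unmixed : Unmixed G) (M₂ : Subset n) (M₂-admissible : AdmissibleM₂ M₂) where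

    minimal⇒size : ∀ K → IsMinimalVertexCover G K → ∣ K ∣ + m ≡ #M + m₂
    minimal⇒size K K-min = trans (cong (_+ m) (unmixed K C₀.R.C K-min C₀.R-minimal)) ∣C₀∣+m

    M₂⊆M : M₂ ⊆ M
    M₂⊆M = proj₁ M₂-admissible

    not-both : ∀ j → ¬ (x₁ j ∈ M₂ × x₂ j ∈ M₂)
    not-both = proj₁ (proj₂ M₂-admissible)

    exclusive : ∀ j → lookup M₂ (x₁ j) ≡ true → lookup M₂ (x₂ j) ≡ false
    exclusive j e = ¬-not λ e₂ → not-both j (lookup⇒[]= _ M₂ e , lookup⇒[]= _ M₂ e₂)

    open Deletion M₂ (λ v e → ∈M⇒∉W (M₂⊆M (lookup⇒[]= v M₂ e)))
    open CoverOfM₂ exclusive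

    #W∩N+m₂′≡m₂ : #W∩N + m₂′ M₂ ≡ m₂
    #W∩N+m₂′≡m₂ = +-cancelˡ-≡ #M _ _ (trans (sym (+-assoc #M _ _)) (trans (sym ∣R∣+m) (minimal⇒size R.C R-minimal)))

    flat₁ : Flat1 M₂
    flat₁ = begin
      m₂ + ∣ M₂ ∣                     ≡⟨ cong (_+ ∣ M₂ ∣) #W∩N+m₂′≡m₂ ⟨
      #W∩N + m₂′ M₂ + ∣ M₂ ∣          ≡⟨ rearrange #W∩N (m₂′ M₂) (∣ M₂ ∣) ⟩
      ∣ M₂ ∣ + #W∩N + m₂′ M₂          ≡⟨ cong (_+ m₂′ M₂) ∣N[M₂]∣≡ ⟨
      ∣ NS G M₂ ∣ + m₂′ M₂            ∎
      where
      open ≡-Reasoning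
      rearrange : ∀ a b c → a + b + c ≡ c + a + b
      rearrange = solve-∀

    -- both contain M₂, and an edge of G_M avoiding M₂ has its first vertex in A and its second in B
    module A = FullPicks (λ j → inM₂ (x₂ j))
    module B = FullPicks (λ j → not (inM₂ (x₁ j)))

    A-#W∩N≡m₂ : A.#W∩N ≡ m₂
    A-#W∩N≡m₂ = +-cancelˡ-≡ #M _ _ (trans (sym A.∣C∣+m-full) (minimal⇒size A.C A.C-minimal-full))

    B-#W∩N≡m₂ : B.#W∩N ≡ m₂
    B-#W∩N≡m₂ = +-cancelˡ-≡ #M _ _ (trans (sym B.∣C∣+m-full) (minimal⇒size B.C B.C-minimal-full))

    exclusive′ : ∀ j → inM₂ (x₂ j) ≡ true → inM₂ (x₁ j) ≡ false
    exclusive′ j e₂ = ¬-not λ e₁ → true≢false (trans (sym e₂) (exclusive j e₁))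

    N⊆A : ∀ v → inN v ≡ true → A.inN v ≡ true
    N⊆A v e with inN-elim v e
    ... | x , x∈M₂ , xv with ∉W⇒InPairs x (∈M⇒∉W (M₂⊆M (lookup⇒[]= x M₂ x∈M₂)))
    ...   | j , inj₁ refl = A.inN-intro _ v (trans (A.T-x₁ j) (cong (λ b → picks₁ (if b then pick₂ else pick₁)) (exclusive j x∈M₂))) xv
    ...   | j , inj₂ refl = A.inN-intro _ v (trans (A.T-x₂ j) (cong (λ b → picks₂ (if b then pick₂ else pick₁)) x∈M₂)) xv

    N⊆B : ∀ v → inN v ≡ true → B.inN v ≡ true
    N⊆B v e with inN-elim v e
    ... | x , x∈M₂ , xv with ∉W⇒InPairs x (∈M⇒∉W (M₂⊆M (lookup⇒[]= x M₂ x∈M₂)))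
    ...   | j , inj₁ refl = B.inN-intro _ v (trans (B.T-x₁ j) (cong (λ b → picks₁ (if not b then pick₂ else pick₁)) x∈M₂)) xv
    ...   | j , inj₂ refl = B.inN-intro _ v (trans (B.T-x₂ j) (cong (λ b → picks₂ (if not b then pick₂ else pick₁)) (exclusive′ j x∈M₂))) xv

    G′-neighbour⇒A∪B : ∀ v z → adj v z ≡ true → inG′ z ≡ true → inW z ≡ false → A.inN v ≡ true ⊎ B.inN v ≡ true
    G′-neighbour⇒A∪B v z vz z∈G′ z∉W with ∉W⇒InPairs z z∉W
    ... | j , inj₁ refl = inj₁ (A.inN-intro _ v (trans (A.T-x₁ j) (cong (λ b → picks₁ (if b then pick₂ else pick₁))
                                 (proj₂ (nor-true⁻ ((trans (sym (inG′-x₁ j)) z∈G′)))))) (adj-sym v _ vz))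
    ... | j , inj₂ refl = inj₂ (B.inN-intro _ v (trans (B.T-x₂ j) (cong (λ b → picks₂ (if not b then pick₂ else pick₁))
                                 (proj₂ (nor-true⁻ ((trans (sym (inG′-x₂ j)) z∈G′)))))) (adj-sym v _ vz))

    W₀-bound : ∀ v → 𝟙 (lookup W₀ v) + 𝟙 (inW v ∧ inN v) ≤
                     𝟙 (inW v ∧ A.inN v) + 𝟙 (inW v ∧ B.inN v) + 𝟙 (lookup (IN M₂) v)
    W₀-bound v = pointwise-bound _ _ _ _ _ (on-W N⊆A) (on-W N⊆B) escape
      where
      on-W : ∀ {X : Fin n → Bool} → (∀ v → inN v ≡ true → X v ≡ true) → inW v ∧ inN v ≡ true → inW v ∧ X v ≡ true
      on-W N⊆X e = let v∈W , v∈N = ∧-true⁻ {inW v} e in ∧-true⁺ v∈W (N⊆X v v∈N)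
      escape : lookup W₀ v ≡ true → inW v ∧ inN v ≡ false →
               inW v ∧ A.inN v ≡ true ⊎ inW v ∧ B.inN v ≡ true ⊎ lookup (IN M₂) v ≡ true
      escape w₀ s with ∧-true⁻ {inW v} (trans (sym (lookup∘tabulate _ v)) w₀)
      ... | v∈W , _ with lookup (Isolated G M₂) v in isolated
      ...   | true = inj₂ (inj₂ (trans (lookup-∩ (Isolated G M₂) W₀ v) (∧-true⁺ isolated w₀)))
      ...   | false with anyᶠ-true⁻ _ (not-injective (trans (sym (cong₂ (λ g a → g ∧ not a) v∈G′ refl))
                                                        (trans (sym (lookup∘tabulate _ v)) isolated)))
        where
        v∈G′ : inG′ v ≡ true
        v∈G′ = trans (inG′-W v v∈W) (cong not (trans (sym (cong (_∧ inN v) v∈W)) s))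
      ...     | z , q with ∧-true⁻ {adj v z} q
      ...       | vz , z∈G′ with G′-neighbour⇒A∪B v z vz z∈G′ (W-neighbour∉W v z v∈W vz)
      ...         | inj₁ a = inj₁ (∧-true⁺ v∈W a)
      ...         | inj₂ b = inj₂ (inj₁ (∧-true⁺ v∈W b))

    flat₂ : Flat2 M₂
    flat₂ = begin
      ∣ W₀ ∣ + ∣ NS G M₂ ∣            ≡⟨ cong (∣ W₀ ∣ +_) ∣N[M₂]∣≡ ⟩
      ∣ W₀ ∣ + (∣ M₂ ∣ + #W∩N)        ≡⟨ x∙yz≈y∙xz (∣ W₀ ∣) (∣ M₂ ∣) #W∩N ⟩
      ∣ M₂ ∣ + (∣ W₀ ∣ + #W∩N)        ≤⟨ +-monoʳ-≤ (∣ M₂ ∣) summed ⟩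
      ∣ M₂ ∣ + (m₂ + m₂ + ∣ IN M₂ ∣)  ≡⟨ rearrange (∣ M₂ ∣) m₂ (∣ IN M₂ ∣) ⟩
      2 * m₂ + ∣ M₂ ∣ + ∣ IN M₂ ∣     ∎
      where
      open ≤-Reasoning
      rearrange : ∀ a b c → a + (b + b + c) ≡ 2 * b + a + c
      rearrange = solve-∀
      summed : ∣ W₀ ∣ + #W∩N ≤ m₂ + m₂ + ∣ IN M₂ ∣
      summed = begin
        ∣ W₀ ∣ + #W∩N
          ≡⟨ cong (_+ #W∩N) (∣p∣≡count W₀) ⟩
        count (lookup W₀) + #W∩N
          ≡⟨ ∑-distrib-+ (𝟙 ∘ lookup W₀) _ ⟨
        sum (λ v → 𝟙 (lookup W₀ v) + 𝟙 (inW v ∧ inN v))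
          ≤⟨ sum-mono-≤ W₀-bound ⟩
        sum (λ v → 𝟙 (inW v ∧ A.inN v) + 𝟙 (inW v ∧ B.inN v) + 𝟙 (lookup (IN M₂) v))
          ≡⟨ ∑-distrib-+ (λ v → 𝟙 (inW v ∧ A.inN v) + 𝟙 (inW v ∧ B.inN v)) _ ⟩
        sum (λ v → 𝟙 (inW v ∧ A.inN v) + 𝟙 (inW v ∧ B.inN v)) + count (lookup (IN M₂))
          ≡⟨ cong₂ _+_ (∑-distrib-+ (λ v → 𝟙 (inW v ∧ A.inN v)) _) (sym (∣p∣≡count (IN M₂))) ⟩
        A.#W∩N + B.#W∩N + ∣ IN M₂ ∣
          ≡⟨ cong₂ (λ a b → a + b + ∣ IN M₂ ∣) A-#W∩N≡m₂ B-#W∩N≡m₂ ⟩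
        m₂ + m₂ + ∣ IN M₂ ∣
          ∎

  unmixed⇒flat : Unmixed G → Flat
  unmixed⇒flat unmixed M₂ M₂-admissible = flat₁ , flat₂
    where open Unmixed⇒Flat unmixed M₂ M₂-admissible

  -- K = (M ∖ T) ∪ (W ∩ N(T)) for T = M ∖ K, and (♭1) for M₂ = {x ∈ T : deg x ≥ 2} evaluates ∣ K ∣
  module Flat⇒Size (flat : Flat) (K : Subset n) (K-min : IsMinimalVertexCover G K) where

    K-cover : IsVertexCover G K
    K-cover = proj₁ K-min

    inK : Fin n → Bool
    inK = lookup K

    outside : ∀ {v} → inK v ≡ true → Σ (Fin n) λ u → adj v u ≡ true × inK u ≡ false
    outside {v} v∈K = let u , vu , u∉K = minimal⇒outsideNeighbours K K-min (lookup⇒[]= v K v∈K) in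
                      u , vu , ¬-not (u∉K ∘ lookup⇒[]= u K)

    K-covers : ∀ u v → adj u v ≡ true → inK u ≡ false → inK v ≡ true
    K-covers u v uv u∉K with K-cover u v uv
    ... | inj₁ u∈K = contradiction (trans (sym ([]=⇒lookup u∈K)) u∉K) true≢false
    ... | inj₂ v∈K = []=⇒lookup v∈K

    T : Fin n → Bool
    T v = not (inW v) ∧ not (inK v)

    T-intro : ∀ v → inW v ≡ false → inK v ≡ false → T v ≡ true
    T-intro v v∉W v∉K = cong₂ (λ a b → not a ∧ not b) v∉W v∉K

    T⊆M : ∀ v → T v ≡ true → inW v ≡ false
    T⊆M v e = not-true⁻ (proj₁ (∧-true⁻ e))

    T∩K≡false : ∀ v → T v ≡ true → inK v ≡ false
    T∩K≡false v e = not-true⁻ (proj₂ (∧-true⁻ {not (inW v)} e))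

    T-oneSided : ∀ j → T (x₁ j) ≡ true → T (x₂ j) ≡ false
    T-oneSided j t₁ = ¬-not λ t₂ → true≢false (trans (sym (K-covers _ _ (pair-edge j) (T∩K≡false _ t₁))) (T∩K≡false _ t₂))

    module C = Transversal T T⊆M T-oneSided

    K≡C : ∀ v → inK v ≡ C.inC v
    K≡C v = by-W (inW v) refl
      where
      by-W : ∀ b → inW v ≡ b → inK v ≡ C.inC v
      by-W false v∉W =
        sym (trans (C.inC-M v v∉W) (trans (cong (λ a → not (not a ∧ not (inK v))) v∉W) (not-involutive (inK v))))
      by-W true v∈W = trans (bool-ext to from) (sym (C.inC-W v v∈W))
        where
        to : inK v ≡ true → C.inN v ≡ true
        to v∈K = let u , vu , u∉K = outside v∈K in
                 C.inN-intro u v (T-intro u (W-neighbour∉W v u v∈W vu) u∉K) (adj-sym v u vu)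
        from : C.inN v ≡ true → inK v ≡ true
        from e = let t , tT , tv = C.inN-elim v e in K-covers t v tv (T∩K≡false t tT)

    ∣K∣≡∣C∣ : ∣ K ∣ ≡ ∣ C.C ∣
    ∣K∣≡∣C∣ = trans (∣p∣≡count K) (trans (sum-cong-≗ (cong 𝟙 ∘ K≡C)) (sym (∣tabulate∣≡count C.inC)))

    M₂ : Subset n
    M₂ = tabulate (λ v → T v ∧ (2 ≤ᵇ deg G v))

    M₂-intro : ∀ v → T v ≡ true → 2 ≤ deg G v → lookup M₂ v ≡ true
    M₂-intro v tv d = trans (lookup∘tabulate _ v) (∧-true⁺ tv (≤ᵇ-true⁺ d))

    M₂-elim : ∀ v → lookup M₂ v ≡ true → T v ≡ true × 2 ≤ deg G v
    M₂-elim v e = let tv , d = ∧-true⁻ (trans (sym (lookup∘tabulate _ v)) e) in tv , ≤ᵇ-true⁻ d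

    M₂-admissible : AdmissibleM₂ M₂
    M₂-admissible = (λ {x} x∈M₂ → ∉W⇒∈M (T⊆M x (proj₁ (M₂-elim x ([]=⇒lookup x∈M₂)))))
                  , (λ j (x₁∈M₂ , x₂∈M₂) → true≢false (trans (sym (proj₁ (M₂-elim _ ([]=⇒lookup x₂∈M₂))))
                                              (T-oneSided j (proj₁ (M₂-elim _ ([]=⇒lookup x₁∈M₂))))))
                  , (λ x x∈M₂ → proj₂ (M₂-elim x ([]=⇒lookup x∈M₂)))

    module D′ = Deletion M₂ (λ v e → T⊆M v (proj₁ (M₂-elim v e)))

    #W∩N+m₂′≡m₂ : D′.#W∩N + m₂′ M₂ ≡ m₂
    #W∩N+m₂′≡m₂ = +-cancelˡ-≡ (∣ M₂ ∣) _ _ (sym (begin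
      ∣ M₂ ∣ + m₂                     ≡⟨ +-comm (∣ M₂ ∣) m₂ ⟩
      m₂ + ∣ M₂ ∣                     ≡⟨ proj₁ (flat M₂ M₂-admissible) ⟩
      ∣ NS G M₂ ∣ + m₂′ M₂            ≡⟨ cong (_+ m₂′ M₂) D′.∣N[M₂]∣≡ ⟩
      ∣ M₂ ∣ + D′.#W∩N + m₂′ M₂       ≡⟨ +-assoc (∣ M₂ ∣) _ _ ⟩
      ∣ M₂ ∣ + (D′.#W∩N + m₂′ M₂)     ∎))
      where open ≡-Reasoning

    -- a vertex of T adjacent to W has degree ≥ 2, its partner being another neighbour
    N[T]≡N[M₂]-on-W : ∀ u → inW u ≡ true → C.inN u ≡ D′.inN u
    N[T]≡N[M₂]-on-W u u∈W = bool-ext to from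
      where
      from : D′.inN u ≡ true → C.inN u ≡ true
      from e = let x , x∈M₂ , xu = D′.inN-elim u e in C.inN-intro x u (proj₁ (M₂-elim x x∈M₂)) xu
      deg≥2 : ∀ t p → adj t u ≡ true → adj t p ≡ true → inW p ≡ false → 2 ≤ deg G t
      deg≥2 t p tu tp p∉W = subst (2 ≤_) (sym (deg≡count t))
        (count≥2 (adj t) u p tu tp λ u≡p → true≢false (trans (sym u∈W) (trans (cong inW u≡p) p∉W)))
      to : C.inN u ≡ true → D′.inN u ≡ true
      to e with C.inN-elim u e
      ... | t , tT , tu with ∉W⇒InPairs t (T⊆M t tT)
      ...   | j , inj₁ refl = D′.inN-intro _ u (M₂-intro _ tT (deg≥2 _ _ tu (pair-edge j) (x₂∉W j))) tu
      ...   | j , inj₂ refl = D′.inN-intro _ u (M₂-intro _ tT (deg≥2 _ _ tu (pair-edge-sym j) (x₁∉W j))) tu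

    same-W-part : ∀ v → 𝟙 (inW v ∧ C.inN v) ≡ 𝟙 (inW v ∧ D′.inN v)
    same-W-part v with inW v in v∈W
    ... | true = cong 𝟙 (N[T]≡N[M₂]-on-W v v∈W)
    ... | false = refl

    deg′≤deg : ∀ x → D′.deg′ x ≤ deg G x
    deg′≤deg x = subst₂ _≤_ (sym (D′.deg′≡count x)) (sym (deg≡count x)) (sum-mono-≤ λ v → 𝟙-∧≤ (adj x v) _)

    ∉T⇒∈K : ∀ v → inW v ≡ false → T v ≡ false → inK v ≡ true
    ∉T⇒∈K v v∉W tv = not-injective (trans (sym (cong (λ a → not a ∧ not (inK v)) v∉W)) tv)

    ∉T⇒∉M₂ : ∀ v → T v ≡ false → lookup M₂ v ≡ false
    ∉T⇒∉M₂ v tv = ¬-not λ e → true≢false (trans (sym (proj₁ (M₂-elim v e))) tv)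

    G′-neighbour : ∀ y p → (∀ v → adj y v ≡ true → inW v ≡ false → v ≡ p) → inK y ≡ true → inK p ≡ true →
                   Σ (Fin n) λ u → adj y u ≡ true × D′.inG′ u ≡ true × inW u ≡ true
    G′-neighbour y p only-p y∈K p∈K with outside y∈K
    ... | u , yu , u∉K with inW u in u∈W
    ...   | false = contradiction (trans (sym p∈K) (trans (cong inK (sym (only-p u yu u∈W))) u∉K)) true≢false
    ...   | true = u , yu , trans (D′.inG′-W u u∈W) (cong not u∉N) , u∈W
      where
      u∉N : D′.inN u ≡ false
      u∉N = trans (sym (N[T]≡N[M₂]-on-W u u∈W)) (trans (sym (C.inC-W u u∈W)) (trans (sym (K≡C u)) u∉K))

    one-per-pair : ∀ j → 𝟙 (T (x₁ j)) + 𝟙 (T (x₂ j)) + 𝟙 (D′.counted j) ≡ 1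
    one-per-pair j = exactly-one _ _ _ x₁∈T⇒¬counted x₂∈T⇒¬counted (T-oneSided j) neither⇒counted
      where
      x₁∈T⇒¬counted : T (x₁ j) ≡ true → D′.counted j ≡ false
      x₁∈T⇒¬counted t₁ = ¬-not λ c → let _ , _ , d₁ , _ = D′.counted-elim j c in
        true≢false (trans (sym c) (D′.M₂-x₁⇒¬counted j (M₂-intro _ t₁ (≤-trans d₁ (deg′≤deg _)))))
      x₂∈T⇒¬counted : T (x₂ j) ≡ true → D′.counted j ≡ false
      x₂∈T⇒¬counted t₂ = ¬-not λ c → let _ , _ , _ , d₂ = D′.counted-elim j c in
        true≢false (trans (sym c) (D′.M₂-x₂⇒¬counted j (M₂-intro _ t₂ (≤-trans d₂ (deg′≤deg _)))))
      neither⇒counted : T (x₁ j) ≡ false → T (x₂ j) ≡ false → D′.counted j ≡ true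
      neither⇒counted t₁ t₂ =
        ∧-true⁺ x₁∈G′ (∧-true⁺ x₂∈G′ (∧-true⁺ (≤ᵇ-true⁺ deg′x₁≥2) (≤ᵇ-true⁺ deg′x₂≥2)))
        where
        x₁∈K = ∉T⇒∈K _ (x₁∉W j) t₁
        x₂∈K = ∉T⇒∈K _ (x₂∉W j) t₂
        x₁∈G′ = trans (D′.inG′-x₁ j) (cong₂ (λ a b → not (a ∨ b)) (∉T⇒∉M₂ _ t₁) (∉T⇒∉M₂ _ t₂))
        x₂∈G′ = trans (D′.inG′-x₂ j) (cong₂ (λ a b → not (a ∨ b)) (∉T⇒∉M₂ _ t₂) (∉T⇒∉M₂ _ t₁))
        deg′x₁≥2 : 2 ≤ D′.deg′ (x₁ j)
        deg′x₁≥2 = let u , x₁u , u∈G′ , u∈W = G′-neighbour _ _ (partner₁ j) x₁∈K x₂∈K in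
                   D′.deg′≥2 _ _ u (pair-edge j) x₂∈G′ (x₂∉W j) x₁u u∈G′ u∈W
        deg′x₂≥2 : 2 ≤ D′.deg′ (x₂ j)
        deg′x₂≥2 = let u , x₂u , u∈G′ , u∈W = G′-neighbour _ _ (partner₂ j) x₂∈K x₁∈K in
                   D′.deg′≥2 _ _ u (pair-edge-sym j) x₁∈G′ (x₁∉W j) x₂u u∈G′ u∈W

    ∣K∣+m : ∣ K ∣ + m ≡ #M + m₂
    ∣K∣+m = begin
      ∣ K ∣ + m                          ≡⟨ cong (_+ m) ∣K∣≡∣C∣ ⟩
      ∣ C.C ∣ + m                        ≡⟨ C.∣C∣+m D′.counted one-per-pair ⟩
      #M + C.#W∩N + count D′.counted     ≡⟨ cong₂ (λ a b → #M + a + b) (sum-cong-≗ same-W-part) (sym D′.m₂′≡count) ⟩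
      #M + D′.#W∩N + m₂′ M₂              ≡⟨ +-assoc #M _ _ ⟩
      #M + (D′.#W∩N + m₂′ M₂)            ≡⟨ cong (#M +_) #W∩N+m₂′≡m₂ ⟩
      #M + m₂                            ∎
      where open ≡-Reasoning

  flat⇒unmixed : Flat → Unmixed G
  flat⇒unmixed flat K L K-min L-min = +-cancelʳ-≡ m _ _ (trans (∣K∣+m flat K K-min) (sym (∣K∣+m flat L L-min)))
    where open Flat⇒Size using (∣K∣+m)

-- Admissible decompositions from dominating induced matchings

record Enumeration {n : ℕ} (P : Fin n → Bool) : Set where
  field
    size : ℕ
    elem : Fin size → Fin n
    elem-injective : ∀ i j → elem i ≡ elem j → i ≡ j
    elem-sound : ∀ i → P (elem i) ≡ true
    elem-complete : ∀ v → P v ≡ true → Σ (Fin size) λ i → elem i ≡ v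

enumerate : ∀ {n} (P : Fin n → Bool) → Enumeration P
enumerate {zero} P = record { size = 0 ; elem = λ () ; elem-injective = λ () ; elem-sound = λ () ; elem-complete = λ () }
enumerate {suc n} P with P zero in P0 | enumerate (P ∘ suc)
... | true | E = record
  { size = suc size
  ; elem = λ { zero → zero ; (suc i) → suc (elem i) }
  ; elem-injective = λ { zero zero _ → refl ; (suc i) (suc j) e → cong suc (elem-injective i j (suc-injective e)) }
  ; elem-sound = λ { zero → P0 ; (suc i) → elem-sound i }
  ; elem-complete = λ { zero _ → zero , refl ; (suc v) Pv → let i , e = elem-complete v Pv in suc i , cong suc e }
  }
  where open Enumeration E
... | false | E = record
  { size = size
  ; elem = suc ∘ elem
  ; elem-injective = λ i j e → elem-injective i j (suc-injective e)
  ; elem-sound = elem-sound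
  ; elem-complete = λ { zero Pv → contradiction (trans (sym Pv) P0) true≢false
                     ; (suc v) Pv → let i , e = elem-complete v Pv in i , cong suc e }
  }
  where open Enumeration E

¬¬-∀-Fin : ∀ {k} {P : Fin k → Set} → (∀ i → ¬ ¬ P i) → ¬ ¬ (∀ i → P i)
¬¬-∀-Fin {zero} _ no-all = no-all λ ()
¬¬-∀-Fin {suc k} {P} ¬¬P no-all = ¬¬P zero λ P0 →
  ¬¬-∀-Fin {P = P ∘ suc} (¬¬P ∘ suc) λ Psuc → no-all λ { zero → P0 ; (suc i) → Psuc i }

-- V = W ⊔ M is admissible exactly when W is independent and every vertex of M has a unique neighbour in M
module MatchingSplit {n : ℕ} (G : Graph n) where
  open Graph G using (adj; irref)
  open GraphProperties G

  outsideNbr : Subset n → Fin n → Fin n → Bool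
  outsideNbr W v u = not (lookup W u) ∧ adj v u

  outsideNbr⁻ : ∀ {W v u} → outsideNbr W v u ≡ true → u ∉ W × adj v u ≡ true
  outsideNbr⁻ e = let u∉W , vu = ∧-true⁻ e in lookup≡false⇒∉ (not-true⁻ u∉W) , vu

  IsMatchingSplit : Subset n → Set
  IsMatchingSplit W = Independent G W × (∀ v → v ∉ W → count (outsideNbr W v) ≡ 1)

  matchingSplit? : ∀ W → Dec (IsMatchingSplit W)
  matchingSplit? W = all? (λ u → all? λ v → (u ∈? W) →-dec (v ∈? W) →-dec ¬? (adj u v ≟ᵇ true))
                     ×-dec all? (λ v → ¬? (v ∈? W) →-dec (count (outsideNbr W v) ≟ℕ 1))

  module FromSplit (W : Subset n) (split : IsMatchingSplit W) where

    partner : Fin n → Fin n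
    partner v with any? (λ u → outsideNbr W v u ≟ᵇ true)
    ... | yes (u , _) = u
    ... | no _ = v

    partner-outsideNbr : ∀ v → v ∉ W → outsideNbr W v (partner v) ≡ true
    partner-outsideNbr v v∉W with any? (λ u → outsideNbr W v u ≟ᵇ true)
    ... | yes (_ , e) = e
    ... | no none = contradiction (count≢0⇒∃ _ (≤-reflexive (sym (proj₂ split v v∉W)))) none

    partner∉W : ∀ v → v ∉ W → partner v ∉ W
    partner∉W v v∉W = proj₁ (outsideNbr⁻ {W} (partner-outsideNbr v v∉W))

    adj-partner : ∀ v → v ∉ W → adj v (partner v) ≡ true
    adj-partner v v∉W = proj₂ (outsideNbr⁻ {W} (partner-outsideNbr v v∉W))

    partner-unique : ∀ v u → v ∉ W → u ∉ W → adj v u ≡ true → u ≡ partner v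
    partner-unique v u v∉W u∉W vu with u ≟ partner v
    ... | yes u≡p = u≡p
    ... | no u≢p = contradiction (subst (2 ≤_) (proj₂ split v v∉W)
                     (count≥2 _ u (partner v) (∧-true⁺ (cong not (∉⇒lookup≡false u∉W)) vu) (partner-outsideNbr v v∉W) u≢p))
                     (λ { (s≤s ()) })

    partner-involutive : ∀ v → v ∉ W → partner (partner v) ≡ v
    partner-involutive v v∉W = sym (partner-unique (partner v) v (partner∉W v v∉W) v∉W (adj-sym v _ (adj-partner v v∉W)))

    isFirst : Fin n → Bool
    isFirst v = not (lookup W v) ∧ (toℕ v <ᵇ toℕ (partner v))

    isFirst⁻ : ∀ v → isFirst v ≡ true → v ∉ W × toℕ v < toℕ (partner v)
    isFirst⁻ v e = let v∉W , lt = ∧-true⁻ e in lookup≡false⇒∉ (not-true⁻ v∉W) , <ᵇ⇒< _ _ (Equivalence.from T-≡ lt)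

    isFirst⁺ : ∀ v → v ∉ W → toℕ v < toℕ (partner v) → isFirst v ≡ true
    isFirst⁺ v v∉W lt = ∧-true⁺ (cong not (∉⇒lookup≡false v∉W)) (Equivalence.to T-≡ (<⇒<ᵇ lt))

    open Enumeration (enumerate isFirst)

    first∉W : ∀ i → elem i ∉ W
    first∉W i = proj₁ (isFirst⁻ _ (elem-sound i))

    first<partner : ∀ i → toℕ (elem i) < toℕ (partner (elem i))
    first<partner i = proj₂ (isFirst⁻ _ (elem-sound i))

    second : Fin size → Fin n
    second = partner ∘ elem

    first≢second : ∀ i j → elem i ≢ second j
    first≢second i j eᵢ≡pⱼ = <-asym (first<partner j) (subst₂ (λ a b → toℕ a < toℕ b) eᵢ≡pⱼ pᵢ≡eⱼ (first<partner i))
      where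
      pᵢ≡eⱼ : partner (elem i) ≡ elem j
      pᵢ≡eⱼ = trans (cong partner eᵢ≡pⱼ) (partner-involutive _ (first∉W j))

    InPairs′ : Fin n → Set
    InPairs′ v = Σ (Fin size) λ j → v ≡ elem j ⊎ v ≡ second j

    ∉W⇒InPairs′ : ∀ v → v ∉ W → InPairs′ v
    ∉W⇒InPairs′ v v∉W with <-cmp (toℕ v) (toℕ (partner v))
    ... | tri< lt _ _ = let j , e = elem-complete v (isFirst⁺ v v∉W lt) in j , inj₁ (sym e)
    ... | tri≈ _ eq _ = contradiction (trans (sym (adj-partner v v∉W)) (subst (λ p → adj v p ≡ false) (toℕ-injective eq) (irref v))) true≢false
    ... | tri> _ _ gt =
      let p∉W = partner∉W v v∉W
          j , e = elem-complete (partner v)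
                    (isFirst⁺ _ p∉W (subst (λ x → toℕ (partner v) < toℕ x) (sym (partner-involutive v v∉W)) gt))
      in j , inj₂ (trans (sym (partner-involutive v v∉W)) (cong partner (sym e)))

    InPairs′⇒∉W : ∀ v → InPairs′ v → v ∉ W
    InPairs′⇒∉W v (j , inj₁ refl) = first∉W j
    InPairs′⇒∉W v (j , inj₂ refl) = partner∉W _ (first∉W j)

    admissible : AdmDec G
    admissible = record
      { W = W ; m = size ; x₁ = elem ; x₂ = second
      ; W-indep = proj₁ split
      ; x₁-inj = elem-injective
      ; x₂-inj = λ i j e → elem-injective i j
                   (trans (sym (partner-involutive _ (first∉W i))) (trans (cong partner e) (partner-involutive _ (first∉W j))))
      ; x₁≢x₂ = first≢second
      ; M-pairs = λ v v∈M → ∉W⇒InPairs′ v (x∈∁p⇒x∉p v∈M)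
      ; pairs-M = λ v p → x∉p⇒x∈∁p (InPairs′⇒∉W v p)
      ; pair-edge = λ j → adj-partner _ (first∉W j)
      ; M-induced = induced
      }
      where
      induced : ∀ u v → u ∈ ∁ W → v ∈ ∁ W → adj u v ≡ true → Σ (Fin size) λ j → SameE G u v (elem j) (second j)
      induced u v u∈M v∈M uv with partner-unique u v (x∈∁p⇒x∉p u∈M) (x∈∁p⇒x∉p v∈M) uv | ∉W⇒InPairs′ u (x∈∁p⇒x∉p u∈M)
      ... | v≡pu | j , inj₁ u≡eⱼ = j , inj₁ (u≡eⱼ , trans v≡pu (cong partner u≡eⱼ))
      ... | v≡pu | j , inj₂ u≡pⱼ = j , inj₂ (u≡pⱼ , trans v≡pu (trans (cong partner u≡pⱼ) (partner-involutive _ (first∉W j))))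

  SameE-trans : ∀ {a b c d e f} → SameE G a b c d → SameE G c d e f → SameE G a b e f
  SameE-trans (inj₁ (refl , refl)) s = s
  SameE-trans (inj₂ (refl , refl)) (inj₁ (refl , refl)) = inj₂ (refl , refl)
  SameE-trans (inj₂ (refl , refl)) (inj₂ (refl , refl)) = inj₁ (refl , refl)

  SameE-sym : ∀ {a b c d} → SameE G a b c d → SameE G c d a b
  SameE-sym (inj₁ (refl , refl)) = inj₁ (refl , refl)
  SameE-sym (inj₂ (refl , refl)) = inj₂ (refl , refl)

  On-transport : ∀ {a b c d x} → SameE G a b c d → On G x a b → On G x c d
  On-transport (inj₁ (refl , refl)) o = o
  On-transport (inj₂ (refl , refl)) (inj₁ e) = inj₂ e
  On-transport (inj₂ (refl , refl)) (inj₂ e) = inj₁ e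

  Covered : EdgeSet G → Fin n → Set
  Covered S x = Σ (Fin n) λ y → S x y ⊎ S y x

  -- the vertices left uncovered by a dominating induced matching split off the matching
  module FromDIM (S : EdgeSet G) (S-dim : IsDominatingInducedMatching G S) (covered? : ∀ v → Dec (Covered S v)) where

    S-edge : ∀ a b → S a b → adj a b ≡ true
    S-edge = proj₁ (proj₁ S-dim)

    S-induced : ∀ a b c d → S a b → S c d → ¬ SameE G a b c d → ThreeDisjoint G a b c d
    S-induced = proj₂ (proj₁ S-dim)

    S-disjoint : ∀ a b c d → S a b → S c d → ¬ SameE G a b c d → DisjointE G a b c d
    S-disjoint = proj₂ (proj₁ (proj₂ S-dim))

    S-maximal : ∀ u v → adj u v ≡ true → ¬ (S u v ⊎ S v u) → ¬ IsMatching G (λ a b → S a b ⊎ SameE G a b u v)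
    S-maximal = proj₂ (proj₂ S-dim)

    W : Subset n
    W = tabulate (λ v → not (does (covered? v)))

    ∈W⇒uncovered : ∀ {v} → v ∈ W → ¬ Covered S v
    ∈W⇒uncovered {v} v∈W c =
      true≢false (trans (sym (trans (sym (lookup∘tabulate _ v)) ([]=⇒lookup v∈W))) (cong not (dec-true (covered? v) c)))

    uncovered⇒∈W : ∀ {v} → ¬ Covered S v → v ∈ W
    uncovered⇒∈W {v} nc = lookup⇒[]= v W (trans (lookup∘tabulate _ v) (cong not (dec-false (covered? v) nc)))

    ∉W⇒covered : ∀ {v} → v ∉ W → Covered S v
    ∉W⇒covered {v} v∉W = decidable-stable (covered? v) (v∉W ∘ uncovered⇒∈W)

    S-covers : ∀ {c d x} → S c d → On G x c d → Covered S x
    S-covers s (inj₁ refl) = _ , inj₁ s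
    S-covers s (inj₂ refl) = _ , inj₂ s

    W-independent : Independent G W
    W-independent u v u∈W v∈W uv = S-maximal u v uv not-in-S (edges , disjoint)
      where
      uncovered : ∀ {x} → On G x u v → ¬ Covered S x
      uncovered (inj₁ refl) = ∈W⇒uncovered u∈W
      uncovered (inj₂ refl) = ∈W⇒uncovered v∈W
      not-in-S : ¬ (S u v ⊎ S v u)
      not-in-S (inj₁ s) = uncovered (inj₁ refl) (S-covers s (inj₁ refl))
      not-in-S (inj₂ s) = uncovered (inj₁ refl) (S-covers s (inj₂ refl))
      edges : ∀ a b → S a b ⊎ SameE G a b u v → adj a b ≡ true
      edges a b (inj₁ s) = S-edge a b s
      edges a b (inj₂ (inj₁ (refl , refl))) = uv
      edges a b (inj₂ (inj₂ (refl , refl))) = adj-sym u v uv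
      disjoint : ∀ a b c d → S a b ⊎ SameE G a b u v → S c d ⊎ SameE G c d u v → ¬ SameE G a b c d → DisjointE G a b c d
      disjoint a b c d (inj₁ s) (inj₁ s′) ne = S-disjoint a b c d s s′ ne
      disjoint a b c d (inj₁ s) (inj₂ cd≡uv) _ =
        (λ a∈cd → uncovered (On-transport cd≡uv a∈cd) (S-covers s (inj₁ refl))) ,
        (λ b∈cd → uncovered (On-transport cd≡uv b∈cd) (S-covers s (inj₂ refl)))
      disjoint a b c d (inj₂ ab≡uv) (inj₁ s′) _ =
        (λ a∈cd → uncovered (On-transport ab≡uv (inj₁ refl)) (S-covers s′ a∈cd)) ,
        (λ b∈cd → uncovered (On-transport ab≡uv (inj₂ refl)) (S-covers s′ b∈cd))
      disjoint a b c d (inj₂ ab≡uv) (inj₂ cd≡uv) ne = contradiction (SameE-trans ab≡uv (SameE-sym cd≡uv)) ne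

    covering-edge : ∀ {x y} → S x y ⊎ S y x →
                    Σ (Fin n) λ a → Σ (Fin n) λ b → S a b × On G x a b × (∀ z → On G z a b → z ≡ x ⊎ z ≡ y)
    covering-edge (inj₁ s) = _ , _ , s , inj₁ refl , λ _ o → o
    covering-edge (inj₂ s) = _ , _ , s , inj₂ refl , λ { _ (inj₁ e) → inj₂ e ; _ (inj₂ e) → inj₁ e }

    -- a second neighbour outside W would give an edge meeting two edges of S
    unique-outside : ∀ v → v ∉ W → count (outsideNbr W v) ≡ 1
    unique-outside v v∉W with ∉W⇒covered v∉W
    ... | p , vp = count≡1 _ p (∧-true⁺ (cong not p∉W) (adj-vp vp)) only-p
      where
      adj-vp : S v p ⊎ S p v → adj v p ≡ true
      adj-vp (inj₁ s) = S-edge v p s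
      adj-vp (inj₂ s) = adj-sym p v (S-edge p v s)
      p∉W : lookup W p ≡ false
      p∉W = ∉⇒lookup≡false λ p∈W → ∈W⇒uncovered p∈W (v , [ inj₂ , inj₁ ]′ vp)
      only-p : ∀ u → u ≢ p → outsideNbr W v u ≡ false
      only-p u u≢p = ¬-not λ e → let u∉W , vu = outsideNbr⁻ {W} e in clash u∉W vu
        where
        clash : u ∉ W → adj v u ≡ true → ⊥
        clash u∉W vu with covering-edge vp | covering-edge (proj₂ (∉W⇒covered u∉W))
        ... | a , b , sab , v∈ab , ab⊆vp | c , d , scd , u∈cd , _ =
          proj₂ (S-induced a b c d sab scd different) (v , u , vu , inj₁ v∈ab , inj₂ u∈cd)
          where
          different : ¬ SameE G a b c d
          different ab≡cd with ab⊆vp u (On-transport (SameE-sym ab≡cd) u∈cd)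
          ... | inj₁ u≡v = adj⇒≢ v u vu (sym u≡v)
          ... | inj₂ u≡p = u≢p u≡p

    split : IsMatchingSplit W
    split = W-independent , unique-outside

  hasDIM⇒¬¬split : HasDIM G → ¬ ¬ Σ (Subset n) IsMatchingSplit
  hasDIM⇒¬¬split (S , S-dim) no-split =
    ¬¬-∀-Fin (λ v → ¬¬-excluded-middle) λ covered? → no-split (_ , FromDIM.split S S-dim covered?)

  hasDIM⇒AdmDec : HasDIM G → AdmDec G
  hasDIM⇒AdmDec dim = let W , W-split = decidable-stable (anySubset? matchingSplit?) (hasDIM⇒¬¬split dim) in
                      FromSplit.admissible W W-split

theorem2p4 : (n : ℕ) (G : Graph n) → HasDIM G →
    (Unmixed G ⇔ Σ (AdmDec G) AdmDec.Flat)
    × (Unmixed G ⇔ ((D : AdmDec G) → AdmDec.Flat D))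
theorem2p4 n G dim =
  mk⇔ (λ unmixed → D₀ , unmixed⇒flat D₀ unmixed) (λ (D , flat) → flat⇒unmixed D flat) ,
  mk⇔ (λ unmixed D → unmixed⇒flat D unmixed) (λ all-flat → flat⇒unmixed D₀ (all-flat D₀))
  where
  open Decomposition using (unmixed⇒flat; flat⇒unmixed)
  D₀ : AdmDec G
  D₀ = MatchingSplit.hasDIM⇒AdmDec G dim
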